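{- Let $\tau$ be a set and let $\mathcal{W}_\tau$ be the operad of acyclic wiring diagrams described in the context. Then $\mathcal{W}_\tau$ is generated (under operadic composition) by the wiring diagrams $\mathsf{sym}$, $\mathsf{seq}$ and $\mathsf{para}$ described in the context, and these generators satisfy the usual axioms of a symmetric monoidal category: unitality and associativity of sequential composition, unitality and associativity of parallel composition, the interchange law, and the permutation (symmetry) axioms.
   Context: Fix a set $\tau$ of types. A $\tau$-typed finite set is a finite set $X$ with a map $X\to\tau$; $\mathbf{Bij}_\tau$ is the category of $\tau$-typed finite sets and type-preserving bijections, and $\oplus$ denotes disjoint union of typed sets. The operad $\mathcal{W}_\tau$ of acyclic wiring diagrams is defined as follows. Objects ("boxes"): pairs $\mathbf{t}=(\mathbf{t}_-,\mathbf{t}_+)$ of $\tau$-typed finite sets (inputs and outputs). Morphisms ("wiring diagrams") $\Phi:\mathbf{t}^1,\dots,\mathbf{t}^n\to\mathbf{v}$: isomorphism classes of spans in $\mathbf{Bij}_\tau$ $$\mathbf{v}_-\oplus\mathbf{t}_+\xleftarrow{\Phi_{\mathrm{src}}}\omega\xrightarrow{\Phi_{\mathrm{tgt}}}\mathbf{t}_-\oplus\mathbf{v}_+,$$ where $\mathbf{t}_\pm=\bigoplus_{i=1}^n\mathbf{t}^i_\pm$; elements of $\omega$ are called wires. They must satisfy the progress condition: setting $\mathbf{t}^i\prec\mathbf{t}^j$ whenever some wire $A$ has $\Phi_{\mathrm{src}}(A)\in\mathbf{t}^i_+$ and $\Phi_{\mathrm{tgt}}(A)\in\mathbf{t}^j_-$,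 the resulting relation must be (generate) a partial order on the inner boxes, i.e. the boxes with these connections form no directed cycle. Identity on $\mathbf{t}$: the identity span on $\mathbf{t}_-\oplus\mathbf{t}_+$. Partial composition: given $\Psi:\mathbf{s}^1,\dots,\mathbf{s}^m\to\mathbf{t}^i$ and $\Phi:\mathbf{t}^1,\dots,\mathbf{t}^n\to\mathbf{v}$, the composite $\Psi\,;_i\,\Phi:\mathbf{t}^1,\dots,\mathbf{t}^{i-1},\mathbf{s}^1,\dots,\mathbf{s}^m,\mathbf{t}^{i+1},\dots,\mathbf{t}^n\to\mathbf{v}$ is defined as follows. Put $\mathbf{u}_-=\mathbf{v}_-\oplus\bigoplus_{j\ne i}\mathbf{t}^j_+$, $\mathbf{u}_+=\bigoplus_{j\neq i}\mathbf{t}^j_-\oplus\mathbf{v}_+$, $\mathbf{s}_\pm=\bigoplus_k\mathbf{s}^k_\pm$. The composite is the span $\mathbf{u}_-\oplus\mathbf{s}_+\leftarrow\omega'\to\mathbf{s}_-\oplus\mathbf{u}_+$ whose wires are obtained by fusing: (i) from $\mathbf{u}_-$ to $\mathbf{s}_-$: pairs (a $\Phi$-wire from $\mathbf{u}_-$ to a port $p\in\mathbf{t}^i_-$, the $\Psi$-wire from $p$ to $\mathbf{s}_-$); (ii) from $\mathbf{u}_-$ to $\mathbf{u}_+$: the $\Phi$-wires from $\mathbf{u}_-$ to $\mathbf{u}_+$, together with triples (a $\Phi$-wire from $\mathbf{u}_-$ to $p\in\mathbf{t}^i_-$, a $\Psi$-wire from $p$ to $q\in\mathbf{t}^i_+$,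 the $\Phi$-wire from $q$ to $\mathbf{u}_+$); (iii) from $\mathbf{s}_+$ to $\mathbf{s}_-$: the $\Psi$-wires between these; (iv) from $\mathbf{s}_+$ to $\mathbf{u}_+$: pairs (a $\Psi$-wire from $\mathbf{s}_+$ to $q\in\mathbf{t}^i_+$, the $\Phi$-wire from $q$ to $\mathbf{u}_+$). Attachment maps are the evident ones. The generating diagrams: (1) for a $\tau$-typed finite set $\omega$ and a type-preserving permutation $\sigma$ of $\omega$, $\mathsf{sym}^\sigma_\omega:()\to(\omega,\omega)$ is the $0$-ary diagram connecting each input $x$ to the output $\sigma(x)$ (with $\mathsf{unit}_\omega=\mathsf{sym}^{\mathrm{id}}_\omega$); (2) for $\tau$-typed finite sets $A,B,C$, $\mathsf{seq}_{(A,B,C)}:(A,B),(B,C)\to(A,C)$ connects the outer inputs $A$ to the inputs of the first box, the outputs $B$ of the first box to the inputs $B$ of the second box, and the outputs of the second box to the outer outputs $C$, each identically; (3) for $\tau$-typed finite sets $A,A',B,B'$, $\mathsf{para}:(A,B),(A',B')\to(A\oplus A',B\oplus B')$ connects the outer inputs $A$ and $A'$ identically to the inputs of the first and second box respectively, and the outputs $B$, $B'$ of the two boxes identically to the outer outputs.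
   Formalization: Generation also permits relabelling box ports along type-preserving bijections; the permutation axioms are: seq of sym with σ, ρ is sym with ρ∘σ, para of them is sym with σ⊕ρ, and para commutes with swapping boxes up to A⊕A′≅A′⊕A. Apart from conventions, each condition added here is assumed in the paper as well or is needed for the statement above to hold. -}

module Defs where

open import Data.Nat using (ℕ; zero; suc; _+_)
open import Data.Fin using (Fin; zero; suc)
open import Data.Fin.Properties using (+↔⊎; 0↔⊥) renaming (_≟_ to _≟ᶠ_)
open import Data.Sum using (_⊎_; inj₁; inj₂; [_,_])
open import Data.Sum.Function.Propositional using (_⊎-↔_)
open import Data.Product using (Σ; Σ-syntax; _×_; _,_; proj₁; proj₂)
open import Data.Empty using (⊥)
open import Data.Unit using (⊤; tt)
open import Data.List using (List; []; _∷_; _++_; length; lookup)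
open import Function using (_∘_; id)
open import Function.Bundles using (Inverse; _↔_; mk↔ₛ′)
open import Function.Properties.Inverse using (↔-sym; ↔-trans; ↔-refl)
open import Relation.Binary.PropositionalEquality using (_≡_; refl; cong; trans; sym)
open import Relation.Nullary using (¬_)
open import Relation.Nullary.Decidable using (False)
open import Relation.Binary.Construct.Closure.Transitive using (TransClosure; _∷_) renaming ([_] to one)

module _ {τ : Set} where

  record TType : Set₁ where
    field
      Carrier : Set
      ty      : Carrier → τ
  open TType public

  record TSet : Set₁ where
    field
      Elt  : Set
      tyₛ  : Elt → τ
      size : ℕ
      enum : Elt ↔ Fin size
  open TSet public

  ⌊_⌋ : TSet → TType
  ⌊ X ⌋ = record { Carrier = Elt X ; ty = tyₛ X }

  record TIso (X Y : TType) : Set where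
    field
      iso  : Carrier X ↔ Carrier Y
      pres : ∀ x → ty Y (Inverse.to iso x) ≡ ty X x
  open TIso public

  app : ∀ {X Y} → TIso X Y → Carrier X → Carrier Y
  app f = Inverse.to (iso f)

  app⁻ : ∀ {X Y} → TIso X Y → Carrier Y → Carrier X
  app⁻ f = Inverse.from (iso f)

  idᵗ : ∀ {X} → TIso X X
  idᵗ = record { iso = ↔-refl ; pres = λ _ → refl }

  _∘ᵗ_ : ∀ {X Y Z} → TIso Y Z → TIso X Y → TIso X Z
  g ∘ᵗ f = record { iso = ↔-trans (iso f) (iso g)
                  ; pres = λ x → trans (pres g (app f x)) (pres f x) }

  symᵗ : ∀ {X Y} → TIso X Y → TIso Y X
  symᵗ {X} {Y} f = record
    { iso  = ↔-sym (iso f)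
    ; pres = λ y → trans (sym (pres f (app⁻ f y)))
                         (cong (ty Y) (Inverse.strictlyInverseˡ (iso f) y)) }

  _⊕_ : TType → TType → TType
  X ⊕ Y = record { Carrier = Carrier X ⊎ Carrier Y ; ty = [ ty X , ty Y ] }

  _⊕ₛ_ : TSet → TSet → TSet
  X ⊕ₛ Y = record
    { Elt  = Elt X ⊎ Elt Y
    ; tyₛ  = [ tyₛ X , tyₛ Y ]
    ; size = size X + size Y
    ; enum = ↔-trans (enum X ⊎-↔ enum Y) (↔-sym +↔⊎) }

  _⊕ᵗ_ : ∀ {X Y X' Y'} → TIso X X' → TIso Y Y' → TIso (X ⊕ Y) (X' ⊕ Y')
  f ⊕ᵗ g = record { iso = iso f ⊎-↔ iso g
                  ; pres = λ { (inj₁ x) → pres f x ; (inj₂ y) → pres g y } }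

  ∅ : TSet
  ∅ = record { Elt = ⊥ ; tyₛ = λ () ; size = 0 ; enum = ↔-sym 0↔⊥ }

  -- Boxes  t = (t₋ , t₊)

  record Box : Set₁ where
    constructor box
    field
      In  : TSet
      Out : TSet
  open Box public

  record BoxIso (s t : Box) : Set where
    field
      isoIn  : TIso ⌊ In s ⌋ ⌊ In t ⌋
      isoOut : TIso ⌊ Out s ⌋ ⌊ Out t ⌋
  open BoxIso public

  idBox : ∀ {t} → BoxIso t t
  idBox = record { isoIn = idᵗ ; isoOut = idᵗ }

  ⨁In ⨁Out : List Box → TType
  ⨁In ts = record { Carrier = Σ[ k ∈ Fin (length ts) ] Elt (In (lookup ts k))
                  ; ty = λ { (k , x) → tyₛ (In (lookup ts k)) x } }
  ⨁Out ts = record { Carrier = Σ[ k ∈ Fin (length ts) ] Elt (Out (lookup ts k))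
                   ; ty = λ { (k , x) → tyₛ (Out (lookup ts k)) x } }

  -- Wiring diagrams  Φ : t¹,…,tⁿ → v  (spans  v₋ ⊕ t₊ ← ω → t₋ ⊕ v₊)

  Prec : ∀ (ts : List Box) (v : Box) {ω : TType}
         → TIso ω (⌊ In v ⌋ ⊕ ⨁Out ts) → TIso ω (⨁In ts ⊕ ⌊ Out v ⌋)
         → Fin (length ts) → Fin (length ts) → Set
  Prec ts v {ω = ω} s t i j =
    Σ[ w ∈ Carrier ω ]
      (Σ[ q ∈ Elt (Out (lookup ts i)) ] app s w ≡ inj₂ (i , q))
    × (Σ[ p ∈ Elt (In (lookup ts j)) ] app t w ≡ inj₁ (j , p))

  record WD (ts : List Box) (v : Box) : Set₁ where
    field
      wires    : TSet
      src      : TIso ⌊ wires ⌋ (⌊ In v ⌋ ⊕ ⨁Out ts)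
      tgt      : TIso ⌊ wires ⌋ (⨁In ts ⊕ ⌊ Out v ⌋)
      progress : ∀ k → ¬ TransClosure (Prec ts v src tgt) k k
  open WD public

  srcF : ∀ {ts v} (Φ : WD ts v) → Elt (wires Φ) → Elt (In v) ⊎ Carrier (⨁Out ts)
  srcF Φ = app (src Φ)

  tgtF : ∀ {ts v} (Φ : WD ts v) → Elt (wires Φ) → Carrier (⨁In ts) ⊎ Elt (Out v)
  tgtF Φ = app (tgt Φ)

  -- With σ = id and all box
  -- isomorphisms identities this is isomorphism of spans, i.e. equality of
  -- morphisms of W_τ.

  record Iso[_,_,_] {ts ts' : List Box} {v v' : Box}
      (σ : Fin (length ts) → Fin (length ts'))
      (βs : ∀ k → BoxIso (lookup ts k) (lookup ts' (σ k)))
      (β : BoxIso v v')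
      (Φ : WD ts v) (Ψ : WD ts' v') : Set where
    field
      wiso    : TIso ⌊ wires Φ ⌋ ⌊ wires Ψ ⌋
      src-com : ∀ w → srcF Ψ (app wiso w) ≡
                  [ (λ x → inj₁ (app (isoIn β) x))
                  , (λ { (k , q) → inj₂ (σ k , app (isoOut (βs k)) q) }) ] (srcF Φ w)
      tgt-com : ∀ w → tgtF Ψ (app wiso w) ≡
                  [ (λ { (k , p) → inj₁ (σ k , app (isoIn (βs k)) p) })
                  , (λ y → inj₂ (app (isoOut β) y)) ] (tgtF Φ w)

  idBoxes : ∀ {ts : List Box} (k : Fin (length ts)) → BoxIso (lookup ts k) (lookup ts k)
  idBoxes _ = idBox

  _≈[_]_ : ∀ {ts v v'} → WD ts v → BoxIso v v' → WD ts v' → Set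
  _≈[_]_ {ts} Φ β Ψ = Iso[ id , idBoxes {ts} , β ] Φ Ψ

  _≈_ : ∀ {ts v} → WD ts v → WD ts v → Set
  Φ ≈ Ψ = Φ ≈[ idBox ] Ψ

  insertAt : (ts : List Box) → Fin (length ts) → List Box → List Box
  insertAt (t ∷ ts) zero    ss = ss ++ ts
  insertAt (t ∷ ts) (suc i) ss = t ∷ insertAt ts i ss

  module _ (F : Box → TSet) where
    P : List Box → Set
    P ts = Σ[ k ∈ Fin (length ts) ] Elt (F (lookup ts k))

    splitApp : ∀ ss ts → P (ss ++ ts) → P ss ⊎ P ts
    splitApp []       ts (k , x)     = inj₂ (k , x)
    splitApp (s ∷ ss) ts (zero , x)  = inj₁ (zero , x)
    splitApp (s ∷ ss) ts (suc k , x) with splitApp ss ts (k , x)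
    ... | inj₁ (j , y) = inj₁ (suc j , y)
    ... | inj₂ y       = inj₂ y

    splitIns : ∀ ts i ss → P (insertAt ts i ss) → P ts ⊎ P ss
    splitIns (t ∷ ts) zero ss x with splitApp ss ts x
    ... | inj₁ y       = inj₂ y
    ... | inj₂ (j , y) = inj₁ (suc j , y)
    splitIns (t ∷ ts) (suc i) ss (zero , x) = inj₁ (zero , x)
    splitIns (t ∷ ts) (suc i) ss (suc k , x) with splitIns ts i ss (k , x)
    ... | inj₁ (j , y) = inj₁ (suc j , y)
    ... | inj₂ y       = inj₂ y

  module Fuse {ts : List Box} {v : Box} {ss : List Box} (i : Fin (length ts))
              (Ψ : WD ss (lookup ts i)) (Φ : WD ts v) where

    tᵢ = lookup ts i
    WΦ = Elt (wires Φ)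
    WΨ = Elt (wires Ψ)

    -- an endpoint of a Φ-wire not lying on box i  (i.e. lying in u₋ resp. u₊)
    OffOut : Elt (In v) ⊎ Carrier (⨁Out ts) → Set
    OffOut (inj₁ _)       = ⊤
    OffOut (inj₂ (k , _)) = False (k ≟ᶠ i)

    OffIn : Carrier (⨁In ts) ⊎ Elt (Out v) → Set
    OffIn (inj₁ (k , _)) = False (k ≟ᶠ i)
    OffIn (inj₂ _)       = ⊤

    -- the wires of the composite, obtained by fusing wires of Φ and Ψ
    data Fused : Set where
      -- (i) from u₋ to s₋
      fI   : (a : WΦ) (b : WΨ) (p : Elt (In tᵢ)) (y : Carrier (⨁In ss))
             → tgtF Φ a ≡ inj₁ (i , p) → srcF Ψ b ≡ inj₁ p → tgtF Ψ b ≡ inj₁ y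
             → OffOut (srcF Φ a) → Fused
      -- (ii) from u₋ to u₊ : a Φ-wire
      fII  : (a : WΦ) → OffOut (srcF Φ a) → OffIn (tgtF Φ a) → Fused
      -- (ii) from u₋ to u₊ : Φ-wire, Ψ-wire, Φ-wire
      fII' : (a : WΦ) (b : WΨ) (a' : WΦ) (p : Elt (In tᵢ)) (q : Elt (Out tᵢ))
             → tgtF Φ a ≡ inj₁ (i , p) → srcF Ψ b ≡ inj₁ p
             → tgtF Ψ b ≡ inj₂ q → srcF Φ a' ≡ inj₂ (i , q)
             → OffOut (srcF Φ a) → OffIn (tgtF Φ a') → Fused
      -- (iii) from s₊ to s₋ : a Ψ-wire
      fIII : (b : WΨ) (x : Carrier (⨁Out ss)) (y : Carrier (⨁In ss))
             → srcF Ψ b ≡ inj₂ x → tgtF Ψ b ≡ inj₁ y → Fused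
      -- (iv) from s₊ to u₊
      fIV  : (b : WΨ) (a' : WΦ) (x : Carrier (⨁Out ss)) (q : Elt (Out tᵢ))
             → srcF Ψ b ≡ inj₂ x → tgtF Ψ b ≡ inj₂ q → srcF Φ a' ≡ inj₂ (i , q)
             → OffIn (tgtF Φ a') → Fused

    FusedT : TType
    FusedT = record
      { Carrier = Fused
      ; ty = λ { (fI a _ _ _ _ _ _ _)         → tyₛ (wires Φ) a
               ; (fII a _ _)                  → tyₛ (wires Φ) a
               ; (fII' a _ _ _ _ _ _ _ _ _ _) → tyₛ (wires Φ) a
               ; (fIII b _ _ _ _)             → tyₛ (wires Ψ) b
               ; (fIV b _ _ _ _ _ _ _)        → tyₛ (wires Ψ) b } }

    SrcFrame TgtFrame : Set
    SrcFrame = Elt (In v) ⊎ (Carrier (⨁Out ts) ⊎ Carrier (⨁Out ss))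
    TgtFrame = (Carrier (⨁In ts) ⊎ Carrier (⨁In ss)) ⊎ Elt (Out v)

    liftS : Elt (In v) ⊎ Carrier (⨁Out ts) → SrcFrame
    liftS (inj₁ x) = inj₁ x
    liftS (inj₂ y) = inj₂ (inj₁ y)

    liftT : Carrier (⨁In ts) ⊎ Elt (Out v) → TgtFrame
    liftT (inj₁ y) = inj₁ (inj₁ y)
    liftT (inj₂ z) = inj₂ z

    fusedSrc : Fused → SrcFrame
    fusedSrc (fI a _ _ _ _ _ _ _)         = liftS (srcF Φ a)
    fusedSrc (fII a _ _)                  = liftS (srcF Φ a)
    fusedSrc (fII' a _ _ _ _ _ _ _ _ _ _) = liftS (srcF Φ a)
    fusedSrc (fIII _ x _ _ _)             = inj₂ (inj₂ x)
    fusedSrc (fIV _ _ x _ _ _ _ _)        = inj₂ (inj₂ x)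

    fusedTgt : Fused → TgtFrame
    fusedTgt (fI _ _ _ y _ _ _ _)          = inj₁ (inj₂ y)
    fusedTgt (fII a _ _)                   = liftT (tgtF Φ a)
    fusedTgt (fII' _ _ a' _ _ _ _ _ _ _ _) = liftT (tgtF Φ a')
    fusedTgt (fIII _ _ y _ _)              = inj₁ (inj₂ y)
    fusedTgt (fIV _ a' _ _ _ _ _ _)        = liftT (tgtF Φ a')

    splitSrc : Elt (In v) ⊎ Carrier (⨁Out (insertAt ts i ss)) → SrcFrame
    splitSrc (inj₁ x) = inj₁ x
    splitSrc (inj₂ y) = inj₂ (splitIns Out ts i ss y)

    splitTgt : Carrier (⨁In (insertAt ts i ss)) ⊎ Elt (Out v) → TgtFrame
    splitTgt (inj₁ y) = inj₁ (splitIns In ts i ss y)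
    splitTgt (inj₂ z) = inj₂ z

  -- IsComposite Ψ i Φ Θ :  Θ represents the partial composite  Ψ ;ᵢ Φ ,
  -- i.e. Θ's span is isomorphic to the span of fused wires.
  record IsComposite {ts : List Box} {v : Box} {ss : List Box}
      (i' : Fin (length ts)) (Ψ : WD ss (lookup ts i')) (Φ : WD ts v)
      (Θ : WD (insertAt ts i' ss) v) : Set where
    open Fuse i' Ψ Φ
    field
      fuse    : TIso ⌊ wires Θ ⌋ FusedT
      src-com : ∀ w → splitSrc (srcF Θ w) ≡ fusedSrc (app fuse w)
      tgt-com : ∀ w → splitTgt (tgtF Θ w) ≡ fusedTgt (app fuse w)

  mkTIso : ∀ {X Y : TType} (f : Carrier X → Carrier Y) (g : Carrier Y → Carrier X)
           → (∀ y → f (g y) ≡ y) → (∀ x → g (f x) ≡ x) → (∀ x → ty Y (f x) ≡ ty X x)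
           → TIso X Y
  mkTIso f g fg gf p = record { iso = mk↔ₛ′ f g fg gf ; pres = p }

  idWD : (t : Box) → WD (t ∷ []) t
  idWD t = record
    { wires = In t ⊕ₛ Out t
    ; src = mkTIso s s⁻ s∘ s⁻∘ (λ { (inj₁ _) → refl ; (inj₂ _) → refl })
    ; tgt = mkTIso g g⁻ g∘ g⁻∘ (λ { (inj₁ _) → refl ; (inj₂ _) → refl })
    ; progress = λ k → noCyc }
    where
    s : Elt (In t) ⊎ Elt (Out t) → Elt (In t) ⊎ Σ (Fin 1) (λ k → Elt (Out (lookup (t ∷ []) k)))
    s (inj₁ x) = inj₁ x
    s (inj₂ y) = inj₂ (zero , y)
    s⁻ : Elt (In t) ⊎ Σ (Fin 1) (λ k → Elt (Out (lookup (t ∷ []) k))) → Elt (In t) ⊎ Elt (Out t)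
    s⁻ (inj₁ x) = inj₁ x
    s⁻ (inj₂ (zero , y)) = inj₂ y
    s∘ : ∀ y → s (s⁻ y) ≡ y
    s∘ (inj₁ x) = refl
    s∘ (inj₂ (zero , y)) = refl
    s⁻∘ : ∀ x → s⁻ (s x) ≡ x
    s⁻∘ (inj₁ x) = refl
    s⁻∘ (inj₂ y) = refl
    g : Elt (In t) ⊎ Elt (Out t) → Σ (Fin 1) (λ k → Elt (In (lookup (t ∷ []) k))) ⊎ Elt (Out t)
    g (inj₁ x) = inj₁ (zero , x)
    g (inj₂ y) = inj₂ y
    g⁻ : Σ (Fin 1) (λ k → Elt (In (lookup (t ∷ []) k))) ⊎ Elt (Out t) → Elt (In t) ⊎ Elt (Out t)
    g⁻ (inj₁ (zero , x)) = inj₁ x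
    g⁻ (inj₂ y) = inj₂ y
    g∘ : ∀ y → g (g⁻ y) ≡ y
    g∘ (inj₁ (zero , x)) = refl
    g∘ (inj₂ y) = refl
    g⁻∘ : ∀ x → g⁻ (g x) ≡ x
    g⁻∘ (inj₁ x) = refl
    g⁻∘ (inj₂ y) = refl
    noPrec : ∀ {i j} → ¬ Prec (t ∷ []) t {⌊ In t ⊕ₛ Out t ⌋}
                          (mkTIso s s⁻ s∘ s⁻∘ (λ { (inj₁ _) → refl ; (inj₂ _) → refl }))
                          (mkTIso g g⁻ g∘ g⁻∘ (λ { (inj₁ _) → refl ; (inj₂ _) → refl })) i j
    noPrec (inj₁ x , (q , ()) , _)
    noPrec (inj₂ y , _ , (p , ()))
    noCyc : ∀ {k} → ¬ TransClosure _ k k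
    noCyc (one r) = noPrec r
    noCyc (r ∷ _) = noPrec r

  symWD : (ω : TSet) (σ : TIso ⌊ ω ⌋ ⌊ ω ⌋) → WD [] (box ω ω)
  symWD ω σ = record
    { wires = ω
    ; src = mkTIso inj₁ s⁻ s∘ (λ _ → refl) (λ _ → refl)
    ; tgt = mkTIso (inj₂ ∘ app σ) g⁻ g∘ g⁻∘ (pres σ)
    ; progress = λ () }
    where
    s⁻ : Elt ω ⊎ Σ (Fin 0) (λ k → Elt (Out (lookup [] k))) → Elt ω
    s⁻ (inj₁ x) = x
    s⁻ (inj₂ (() , _))
    s∘ : ∀ y → inj₁ (s⁻ y) ≡ y
    s∘ (inj₁ x) = refl
    s∘ (inj₂ (() , _))
    g⁻ : Σ (Fin 0) (λ k → Elt (In (lookup [] k))) ⊎ Elt ω → Elt ω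
    g⁻ (inj₁ (() , _))
    g⁻ (inj₂ y) = app⁻ σ y
    g∘ : ∀ y → inj₂ (app σ (g⁻ y)) ≡ y
    g∘ (inj₁ (() , _))
    g∘ (inj₂ y) = cong inj₂ (Inverse.strictlyInverseˡ (iso σ) y)
    g⁻∘ : ∀ x → g⁻ (inj₂ (app σ x)) ≡ x
    g⁻∘ x = Inverse.strictlyInverseʳ (iso σ) x

  unitWD : (ω : TSet) → WD [] (box ω ω)
  unitWD ω = symWD ω idᵗ

  seqWD : (A B C : TSet) → WD (box A B ∷ box B C ∷ []) (box A C)
  seqWD A B C = record
    { wires = A ⊕ₛ (B ⊕ₛ C)
    ; src = S
    ; tgt = T
    ; progress = noCyc }
    where
    ts = box A B ∷ box B C ∷ []
    OutS = Σ (Fin 2) (λ k → Elt (Out (lookup ts k)))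
    InS  = Σ (Fin 2) (λ k → Elt (In (lookup ts k)))
    W = Elt A ⊎ (Elt B ⊎ Elt C)
    s : W → Elt A ⊎ OutS
    s (inj₁ a) = inj₁ a
    s (inj₂ (inj₁ b)) = inj₂ (zero , b)
    s (inj₂ (inj₂ c)) = inj₂ (suc zero , c)
    s⁻ : Elt A ⊎ OutS → W
    s⁻ (inj₁ a) = inj₁ a
    s⁻ (inj₂ (zero , b)) = inj₂ (inj₁ b)
    s⁻ (inj₂ (suc zero , c)) = inj₂ (inj₂ c)
    s∘ : ∀ y → s (s⁻ y) ≡ y
    s∘ (inj₁ a) = refl
    s∘ (inj₂ (zero , b)) = refl
    s∘ (inj₂ (suc zero , c)) = refl
    s⁻∘ : ∀ x → s⁻ (s x) ≡ x
    s⁻∘ (inj₁ a) = refl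
    s⁻∘ (inj₂ (inj₁ b)) = refl
    s⁻∘ (inj₂ (inj₂ c)) = refl
    g : W → InS ⊎ Elt C
    g (inj₁ a) = inj₁ (zero , a)
    g (inj₂ (inj₁ b)) = inj₁ (suc zero , b)
    g (inj₂ (inj₂ c)) = inj₂ c
    g⁻ : InS ⊎ Elt C → W
    g⁻ (inj₁ (zero , a)) = inj₁ a
    g⁻ (inj₁ (suc zero , b)) = inj₂ (inj₁ b)
    g⁻ (inj₂ c) = inj₂ (inj₂ c)
    g∘ : ∀ y → g (g⁻ y) ≡ y
    g∘ (inj₁ (zero , a)) = refl
    g∘ (inj₁ (suc zero , b)) = refl
    g∘ (inj₂ c) = refl
    g⁻∘ : ∀ x → g⁻ (g x) ≡ x
    g⁻∘ (inj₁ a) = refl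
    g⁻∘ (inj₂ (inj₁ b)) = refl
    g⁻∘ (inj₂ (inj₂ c)) = refl
    S : TIso ⌊ A ⊕ₛ (B ⊕ₛ C) ⌋ (⌊ A ⌋ ⊕ ⨁Out ts)
    S = mkTIso s s⁻ s∘ s⁻∘ (λ { (inj₁ _) → refl ; (inj₂ (inj₁ _)) → refl ; (inj₂ (inj₂ _)) → refl })
    T : TIso ⌊ A ⊕ₛ (B ⊕ₛ C) ⌋ (⨁In ts ⊕ ⌊ C ⌋)
    T = mkTIso g g⁻ g∘ g⁻∘ (λ { (inj₁ _) → refl ; (inj₂ (inj₁ _)) → refl ; (inj₂ (inj₂ _)) → refl })
    -- the only relation is  box 0 ≺ box 1
    notTo0 : ∀ {i} → ¬ Prec ts (box A C) S T i zero
    notTo0 (inj₁ a , (q , ()) , _)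
    notTo0 (inj₂ (inj₁ b) , _ , (p , ()))
    notTo0 (inj₂ (inj₂ c) , _ , (p , ()))
    notFrom1 : ∀ {j} → ¬ Prec ts (box A C) S T (suc zero) j
    notFrom1 (inj₁ a , (q , ()) , _)
    notFrom1 (inj₂ (inj₁ b) , (q , ()) , _)
    notFrom1 (inj₂ (inj₂ c) , _ , (p , ()))
    notPlusTo0 : ∀ {i} → ¬ TransClosure (Prec ts (box A C) S T) i zero
    notPlusTo0 (one r) = notTo0 r
    notPlusTo0 (_ ∷ rs) = notPlusTo0 rs
    noCyc : ∀ k → ¬ TransClosure (Prec ts (box A C) S T) k k
    noCyc zero c = notPlusTo0 c
    noCyc (suc zero) (one r) = notFrom1 r
    noCyc (suc zero) (r ∷ _) = notFrom1 r

  paraWD : (A A' B B' : TSet) → WD (box A B ∷ box A' B' ∷ []) (box (A ⊕ₛ A') (B ⊕ₛ B'))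
  paraWD A A' B B' = record
    { wires = (A ⊕ₛ A') ⊕ₛ (B ⊕ₛ B')
    ; src = S
    ; tgt = T
    ; progress = λ k → noCyc }
    where
    ts = box A B ∷ box A' B' ∷ []
    OutS = Σ (Fin 2) (λ k → Elt (Out (lookup ts k)))
    InS  = Σ (Fin 2) (λ k → Elt (In (lookup ts k)))
    W = (Elt A ⊎ Elt A') ⊎ (Elt B ⊎ Elt B')
    s : W → (Elt A ⊎ Elt A') ⊎ OutS
    s (inj₁ x) = inj₁ x
    s (inj₂ (inj₁ b)) = inj₂ (zero , b)
    s (inj₂ (inj₂ b')) = inj₂ (suc zero , b')
    s⁻ : (Elt A ⊎ Elt A') ⊎ OutS → W
    s⁻ (inj₁ x) = inj₁ x
    s⁻ (inj₂ (zero , b)) = inj₂ (inj₁ b)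
    s⁻ (inj₂ (suc zero , b')) = inj₂ (inj₂ b')
    s∘ : ∀ y → s (s⁻ y) ≡ y
    s∘ (inj₁ x) = refl
    s∘ (inj₂ (zero , b)) = refl
    s∘ (inj₂ (suc zero , b')) = refl
    s⁻∘ : ∀ x → s⁻ (s x) ≡ x
    s⁻∘ (inj₁ x) = refl
    s⁻∘ (inj₂ (inj₁ b)) = refl
    s⁻∘ (inj₂ (inj₂ b')) = refl
    g : W → InS ⊎ (Elt B ⊎ Elt B')
    g (inj₁ (inj₁ a)) = inj₁ (zero , a)
    g (inj₁ (inj₂ a')) = inj₁ (suc zero , a')
    g (inj₂ y) = inj₂ y
    g⁻ : InS ⊎ (Elt B ⊎ Elt B') → W
    g⁻ (inj₁ (zero , a)) = inj₁ (inj₁ a)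
    g⁻ (inj₁ (suc zero , a')) = inj₁ (inj₂ a')
    g⁻ (inj₂ y) = inj₂ y
    g∘ : ∀ y → g (g⁻ y) ≡ y
    g∘ (inj₁ (zero , a)) = refl
    g∘ (inj₁ (suc zero , a')) = refl
    g∘ (inj₂ y) = refl
    g⁻∘ : ∀ x → g⁻ (g x) ≡ x
    g⁻∘ (inj₁ (inj₁ a)) = refl
    g⁻∘ (inj₁ (inj₂ a')) = refl
    g⁻∘ (inj₂ y) = refl
    S : TIso ⌊ (A ⊕ₛ A') ⊕ₛ (B ⊕ₛ B') ⌋ (⌊ A ⊕ₛ A' ⌋ ⊕ ⨁Out ts)
    S = mkTIso s s⁻ s∘ s⁻∘ (λ { (inj₁ _) → refl ; (inj₂ (inj₁ _)) → refl ; (inj₂ (inj₂ _)) → refl })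
    T : TIso ⌊ (A ⊕ₛ A') ⊕ₛ (B ⊕ₛ B') ⌋ (⨁In ts ⊕ ⌊ B ⊕ₛ B' ⌋)
    T = mkTIso g g⁻ g∘ g⁻∘ (λ { (inj₁ (inj₁ _)) → refl ; (inj₁ (inj₂ _)) → refl ; (inj₂ _) → refl })
    noPrec : ∀ {i j} → ¬ Prec ts (box (A ⊕ₛ A') (B ⊕ₛ B')) S T i j
    noPrec (inj₁ x , (q , ()) , _)
    noPrec (inj₂ y , _ , (p , ()))
    noCyc : ∀ {k} → ¬ TransClosure (Prec ts (box (A ⊕ₛ A') (B ⊕ₛ B')) S T) k k
    noCyc (one r) = noPrec r
    noCyc (r ∷ _) = noPrec r

  -- Generation: the sub-collection of W_τ generated by sym, seq, para under
  -- the (symmetric, coloured) operad structure: identities, partial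
  -- composition, the symmetric-group action on inputs, and transport along
  -- isomorphisms of boxes (colours are typed finite sets, i.e. objects of the
  -- groupoid Bij_τ).  It is closed under equality (≈) of morphisms.

  data Generated : {ts : List Box} {v : Box} → WD ts v → Set₁ where
    gen-sym  : ∀ ω σ → Generated (symWD ω σ)
    gen-seq  : ∀ A B C → Generated (seqWD A B C)
    gen-para : ∀ A A' B B' → Generated (paraWD A A' B B')
    gen-id   : ∀ t → Generated (idWD t)
    gen-comp : ∀ {ts v ss} {i : Fin (length ts)} {Φ : WD ts v}
                 {Ψ : WD ss (lookup ts i)} {Θ : WD (insertAt ts i ss) v}
               → Generated Ψ → Generated Φ → IsComposite i Ψ Φ Θ → Generated Θ
    gen-iso  : ∀ {ts ts' v v'} {Φ : WD ts v} {Ψ : WD ts' v'}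
                 (σ : Fin (length ts) ↔ Fin (length ts'))
                 (βs : ∀ k → BoxIso (lookup ts k) (lookup ts' (Inverse.to σ k)))
                 (β : BoxIso v v')
               → Generated Φ → Iso[ Inverse.to σ , βs , β ] Φ Ψ → Generated Ψ

  ⊕-unitˡ : ∀ (A : TSet) → TIso ⌊ ∅ ⊕ₛ A ⌋ ⌊ A ⌋
  ⊕-unitˡ A = mkTIso f inj₂ (λ _ → refl) (λ { (inj₂ _) → refl }) (λ { (inj₂ _) → refl })
    where f : ⊥ ⊎ Elt A → Elt A
          f (inj₂ a) = a

  ⊕-unitʳ : ∀ (A : TSet) → TIso ⌊ A ⊕ₛ ∅ ⌋ ⌊ A ⌋
  ⊕-unitʳ A = mkTIso f inj₁ (λ _ → refl) (λ { (inj₁ _) → refl }) (λ { (inj₁ _) → refl })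
    where f : Elt A ⊎ ⊥ → Elt A
          f (inj₁ a) = a

  ⊕-assoc : ∀ (A B C : TSet) → TIso ⌊ (A ⊕ₛ B) ⊕ₛ C ⌋ ⌊ A ⊕ₛ (B ⊕ₛ C) ⌋
  ⊕-assoc A B C = mkTIso f g fg gf p
    where
    f : (Elt A ⊎ Elt B) ⊎ Elt C → Elt A ⊎ (Elt B ⊎ Elt C)
    f (inj₁ (inj₁ a)) = inj₁ a
    f (inj₁ (inj₂ b)) = inj₂ (inj₁ b)
    f (inj₂ c) = inj₂ (inj₂ c)
    g : Elt A ⊎ (Elt B ⊎ Elt C) → (Elt A ⊎ Elt B) ⊎ Elt C
    g (inj₁ a) = inj₁ (inj₁ a)
    g (inj₂ (inj₁ b)) = inj₁ (inj₂ b)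
    g (inj₂ (inj₂ c)) = inj₂ c
    fg : ∀ y → f (g y) ≡ y
    fg (inj₁ a) = refl
    fg (inj₂ (inj₁ b)) = refl
    fg (inj₂ (inj₂ c)) = refl
    gf : ∀ x → g (f x) ≡ x
    gf (inj₁ (inj₁ a)) = refl
    gf (inj₁ (inj₂ b)) = refl
    gf (inj₂ c) = refl
    p : ∀ x → [ tyₛ A , [ tyₛ B , tyₛ C ] ] (f x) ≡ [ [ tyₛ A , tyₛ B ] , tyₛ C ] x
    p (inj₁ (inj₁ a)) = refl
    p (inj₁ (inj₂ b)) = refl
    p (inj₂ c) = refl

  ⊕-comm : ∀ (A B : TSet) → TIso ⌊ A ⊕ₛ B ⌋ ⌊ B ⊕ₛ A ⌋
  ⊕-comm A B = mkTIso f g fg gf p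
    where
    f : Elt A ⊎ Elt B → Elt B ⊎ Elt A
    f (inj₁ a) = inj₂ a
    f (inj₂ b) = inj₁ b
    g : Elt B ⊎ Elt A → Elt A ⊎ Elt B
    g (inj₁ b) = inj₂ b
    g (inj₂ a) = inj₁ a
    fg : ∀ y → f (g y) ≡ y
    fg (inj₁ b) = refl
    fg (inj₂ a) = refl
    gf : ∀ x → g (f x) ≡ x
    gf (inj₁ a) = refl
    gf (inj₂ b) = refl
    p : ∀ x → [ tyₛ B , tyₛ A ] (f x) ≡ [ tyₛ A , tyₛ B ] x
    p (inj₁ a) = refl
    p (inj₂ b) = refl

  swap01 : Fin 2 → Fin 2
  swap01 zero = suc zero
  swap01 (suc zero) = zero

  swap12 : Fin 4 → Fin 4
  swap12 zero = zero
  swap12 (suc zero) = suc (suc zero)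
  swap12 (suc (suc zero)) = suc zero
  swap12 (suc (suc (suc zero))) = suc (suc (suc zero))

  idBoxes01 : (b₀ b₁ : Box) (k : Fin 2)
              → BoxIso (lookup (b₀ ∷ b₁ ∷ []) k) (lookup (b₁ ∷ b₀ ∷ []) (swap01 k))
  idBoxes01 b₀ b₁ zero = idBox
  idBoxes01 b₀ b₁ (suc zero) = idBox

  idBoxes12 : (b₀ b₁ b₂ b₃ : Box) (k : Fin 4)
              → BoxIso (lookup (b₀ ∷ b₁ ∷ b₂ ∷ b₃ ∷ []) k)
                       (lookup (b₀ ∷ b₂ ∷ b₁ ∷ b₃ ∷ []) (swap12 k))
  idBoxes12 b₀ b₁ b₂ b₃ zero = idBox
  idBoxes12 b₀ b₁ b₂ b₃ (suc zero) = idBox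
  idBoxes12 b₀ b₁ b₂ b₃ (suc (suc zero)) = idBox
  idBoxes12 b₀ b₁ b₂ b₃ (suc (suc (suc zero))) = idBox

  GeneratedBySymSeqPara : Set₁
  GeneratedBySymSeqPara = ∀ {ts v} (Φ : WD ts v) → Generated Φ

  SeqUnital : Set₁
  SeqUnital = ∀ (A B : TSet)
    → IsComposite zero (unitWD A) (seqWD A A B) (idWD (box A B))
    × IsComposite (suc zero) (unitWD B) (seqWD A B B) (idWD (box A B))

  SeqAssoc : Set₁
  SeqAssoc = ∀ (A B C D : TSet)
    → Σ[ Θ ∈ WD (box A B ∷ box B C ∷ box C D ∷ []) (box A D) ]
        IsComposite (suc zero) (seqWD B C D) (seqWD A B D) Θ
      × IsComposite zero (seqWD A B C) (seqWD A C D) Θ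

  ParaUnital : Set₁
  ParaUnital = ∀ (A B : TSet)
    → (Σ[ Θ ∈ WD (box A B ∷ []) (box (∅ ⊕ₛ A) (∅ ⊕ₛ B)) ]
         IsComposite zero (unitWD ∅) (paraWD ∅ A ∅ B) Θ
       × Θ ≈[ record { isoIn = ⊕-unitˡ A ; isoOut = ⊕-unitˡ B } ] idWD (box A B))
    × (Σ[ Θ ∈ WD (box A B ∷ []) (box (A ⊕ₛ ∅) (B ⊕ₛ ∅)) ]
         IsComposite (suc zero) (unitWD ∅) (paraWD A ∅ B ∅) Θ
       × Θ ≈[ record { isoIn = ⊕-unitʳ A ; isoOut = ⊕-unitʳ B } ] idWD (box A B))

  ParaAssoc : Set₁
  ParaAssoc = ∀ (A A' A'' B B' B'' : TSet)
    → Σ[ Θ₁ ∈ WD (box A B ∷ box A' B' ∷ box A'' B'' ∷ [])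
                 (box ((A ⊕ₛ A') ⊕ₛ A'') ((B ⊕ₛ B') ⊕ₛ B'')) ]
      Σ[ Θ₂ ∈ WD (box A B ∷ box A' B' ∷ box A'' B'' ∷ [])
                 (box (A ⊕ₛ (A' ⊕ₛ A'')) (B ⊕ₛ (B' ⊕ₛ B''))) ]
        IsComposite zero (paraWD A A' B B') (paraWD (A ⊕ₛ A') A'' (B ⊕ₛ B') B'') Θ₁
      × IsComposite (suc zero) (paraWD A' A'' B' B'') (paraWD A (A' ⊕ₛ A'') B (B' ⊕ₛ B'')) Θ₂
      × Θ₁ ≈[ record { isoIn = ⊕-assoc A A' A'' ; isoOut = ⊕-assoc B B' B'' } ] Θ₂

  -- interchange law:  para(seq(f,g), seq(f',g')) = seq(para(f,f'), para(g,g')),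
  -- the two sides having their inner boxes listed in orders differing by (1 2)
  Interchange : Set₁
  Interchange = ∀ (A A' B B' C C' : TSet)
    → Σ[ Θ₁ ∈ WD (box A C ∷ box A' B' ∷ box B' C' ∷ []) (box (A ⊕ₛ A') (C ⊕ₛ C')) ]
      Σ[ L  ∈ WD (box A B ∷ box B C ∷ box A' B' ∷ box B' C' ∷ []) (box (A ⊕ₛ A') (C ⊕ₛ C')) ]
      Σ[ Θ₂ ∈ WD (box (A ⊕ₛ A') (B ⊕ₛ B') ∷ box B C ∷ box B' C' ∷ []) (box (A ⊕ₛ A') (C ⊕ₛ C')) ]
      Σ[ R  ∈ WD (box A B ∷ box A' B' ∷ box B C ∷ box B' C' ∷ []) (box (A ⊕ₛ A') (C ⊕ₛ C')) ]
        IsComposite (suc zero) (seqWD A' B' C') (paraWD A A' C C') Θ₁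
      × IsComposite zero (seqWD A B C) Θ₁ L
      × IsComposite (suc zero) (paraWD B B' C C') (seqWD (A ⊕ₛ A') (B ⊕ₛ B') (C ⊕ₛ C')) Θ₂
      × IsComposite zero (paraWD A A' B B') Θ₂ R
      × Iso[ swap12 , idBoxes12 (box A B) (box B C) (box A' B') (box B' C') , idBox ] L R

  PermSeq : Set₁
  PermSeq = ∀ (ω : TSet) (σ ρ : TIso ⌊ ω ⌋ ⌊ ω ⌋)
    → Σ[ Θ₁ ∈ WD (box ω ω ∷ []) (box ω ω) ]
      Σ[ Θ ∈ WD [] (box ω ω) ]
        IsComposite (suc zero) (symWD ω ρ) (seqWD ω ω ω) Θ₁
      × IsComposite zero (symWD ω σ) Θ₁ Θ
      × Θ ≈ symWD ω (ρ ∘ᵗ σ)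

  PermPara : Set₁
  PermPara = ∀ (ω ω' : TSet) (σ : TIso ⌊ ω ⌋ ⌊ ω ⌋) (ρ : TIso ⌊ ω' ⌋ ⌊ ω' ⌋)
    → Σ[ Θ₁ ∈ WD (box ω ω ∷ []) (box (ω ⊕ₛ ω') (ω ⊕ₛ ω')) ]
      Σ[ Θ ∈ WD [] (box (ω ⊕ₛ ω') (ω ⊕ₛ ω')) ]
        IsComposite (suc zero) (symWD ω' ρ) (paraWD ω ω' ω ω') Θ₁
      × IsComposite zero (symWD ω σ) Θ₁ Θ
      × Θ ≈ symWD (ω ⊕ₛ ω') (σ ⊕ᵗ ρ)

  PermSwap : Set₁
  PermSwap = ∀ (A A' B B' : TSet)
    → Iso[ swap01 , idBoxes01 (box A B) (box A' B')
         , record { isoIn = ⊕-comm A A' ; isoOut = ⊕-comm B B' } ]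
        (paraWD A A' B B') (paraWD A' A B' B)

-- A wiring diagram is determined up to isomorphism by its connection bijection
-- v₋ ⊕ t₊ ≅ t₋ ⊕ v₊, which sends a port to the other end of the wire leaving it.
-- Composites and isomorphisms of diagrams can therefore be recognised on
-- connection maps, and every axiom becomes a finite computation with explicit
-- diagrams.  For generation, the progress condition provides an inner box t
-- that receives no wire from another inner box, so all its inputs are outer
-- inputs.  Writing R for the remaining outer inputs, the diagram is then the
-- generated diagram "t in parallel with the identity on R, followed by a box X"
-- with a diagram having one inner box fewer plugged into X.  Induction on the
-- number of inner boxes ends with diagrams without inner boxes, which are
-- symmetries.
module Submission where

open import Defs
open import Axiom.UniquenessOfIdentityProofs.WithK using (uip)
open import Data.Bool using (Bool; true; false; not; T)
open import Data.Bool.Properties using (T-irrelevant)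
open import Data.Empty using (⊥; ⊥-elim)
open import Data.Fin using (Fin; zero; suc; toℕ)
open import Data.Fin.Properties using (+↔⊎; pigeonhole; any?; all?; ¬∀⟶∃¬)
  renaming (_≟_ to _≟ᶠ_; suc-injective to Fin-suc-injective)
open import Data.List using (List; []; _∷_; _++_; length; lookup; removeAt)
open import Data.List.Properties using (length-removeAt′)
open import Data.Nat using (ℕ; zero; suc; _+_; _<_; z≤n; s≤s)
open import Data.Nat.Properties using (<-trans; <-irrefl; n<1+n; m≤n⇒m<n∨m≡n; suc-injective)
open import Data.Product using (Σ; Σ-syntax; _×_; _,_; proj₁; proj₂)
open import Data.Sum using (_⊎_; inj₁; inj₂; [_,_])
open import Data.Sum.Function.Propositional using (_⊎-↔_)
open import Data.Sum.Properties using (inj₁-injective; inj₂-injective)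
open import Data.Unit using (tt)
open import Function using (_∘_; id)
open import Function.Bundles using (Inverse; _↔_; mk↔ₛ′)
open import Function.Properties.Inverse using (↔-sym; ↔-trans)
open import Relation.Binary.Construct.Closure.Transitive using (TransClosure; _∷_; transitive⁻)
  renaming ([_] to one)
open import Relation.Binary.PropositionalEquality
  using (_≡_; refl; sym; trans; cong; subst; subst₂; _≗_)
open import Relation.Nullary using (¬_; Dec; yes; no)
open import Relation.Nullary.Decidable using (False; fromWitnessFalse; toWitnessFalse)

tc-map : ∀ {A B : Set} {R : A → A → Set} {S : B → B → Set} (f : A → B)
         → (∀ {i j} → R i j → S (f i) (f j)) → ∀ {i j} → TransClosure R i j → TransClosure S (f i) (f j)
tc-map f h (one r)  = one (h r)
tc-map f h (r ∷ rs) = h r ∷ tc-map f h rs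

module _ {τ : Set} where

  app∘app⁻ : ∀ {X Y : TType {τ}} (f : TIso X Y) y → app f (app⁻ f y) ≡ y
  app∘app⁻ f = Inverse.strictlyInverseˡ (iso f)

  app⁻∘app : ∀ {X Y : TType {τ}} (f : TIso X Y) x → app⁻ f (app f x) ≡ x
  app⁻∘app f = Inverse.strictlyInverseʳ (iso f)

  app-injective : ∀ {X Y : TType {τ}} (f : TIso X Y) {x x'} → app f x ≡ app f x' → x ≡ x'
  app-injective f {x} {x'} e = trans (sym (app⁻∘app f x)) (trans (cong (app⁻ f) e) (app⁻∘app f x'))

  False-suc⁻ : ∀ {n} {k i : Fin n} → False (suc k ≟ᶠ suc i) → False (k ≟ᶠ i)
  False-suc⁻ k≢i = fromWitnessFalse (toWitnessFalse k≢i ∘ cong suc)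

  False-suc : ∀ {n} {k i : Fin n} → False (k ≟ᶠ i) → False (suc k ≟ᶠ suc i)
  False-suc k≢i = fromWitnessFalse (toWitnessFalse k≢i ∘ Fin-suc-injective)

  module _ (F : Box {τ} → TSet {τ}) where

    sucᴾ : ∀ {b bs} → P F bs → P F (b ∷ bs)
    sucᴾ (k , x) = suc k , x

    tyᴾ : ∀ bs → P F bs → τ
    tyᴾ bs (k , x) = tyₛ (F (lookup bs k)) x

    injectˡ : ∀ ss ts → P F ss → P F (ss ++ ts)
    injectˡ (s ∷ ss) ts (zero , x)  = zero , x
    injectˡ (s ∷ ss) ts (suc k , x) = sucᴾ (injectˡ ss ts (k , x))

    injectʳ : ∀ ss ts → P F ts → P F (ss ++ ts)
    injectʳ []       ts y = y
    injectʳ (s ∷ ss) ts y = sucᴾ (injectʳ ss ts y)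

    splitApp-injectˡ : ∀ ss ts y → splitApp F ss ts (injectˡ ss ts y) ≡ inj₁ y
    splitApp-injectˡ (s ∷ ss) ts (zero , x) = refl
    splitApp-injectˡ (s ∷ ss) ts (suc k , x) rewrite splitApp-injectˡ ss ts (k , x) = refl

    splitApp-injectʳ : ∀ ss ts y → splitApp F ss ts (injectʳ ss ts y) ≡ inj₂ y
    splitApp-injectʳ []       ts y = refl
    splitApp-injectʳ (s ∷ ss) ts y rewrite splitApp-injectʳ ss ts y = refl

    injectˡ-splitApp : ∀ ss ts y z → splitApp F ss ts y ≡ inj₁ z → y ≡ injectˡ ss ts z
    injectˡ-splitApp [] ts y z ()
    injectˡ-splitApp (s ∷ ss) ts (zero , x) .(zero , x) refl = refl
    injectˡ-splitApp (s ∷ ss) ts (suc k , x) z eq with splitApp F ss ts (k , x) in e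
    injectˡ-splitApp (s ∷ ss) ts (suc k , x) .(suc j , y) refl | inj₁ (j , y) =
      cong sucᴾ (injectˡ-splitApp ss ts (k , x) (j , y) e)
    injectˡ-splitApp (s ∷ ss) ts (suc k , x) z () | inj₂ _

    injectʳ-splitApp : ∀ ss ts y z → splitApp F ss ts y ≡ inj₂ z → y ≡ injectʳ ss ts z
    injectʳ-splitApp [] ts y .y refl = refl
    injectʳ-splitApp (s ∷ ss) ts (zero , x) z ()
    injectʳ-splitApp (s ∷ ss) ts (suc k , x) z eq with splitApp F ss ts (k , x) in e
    injectʳ-splitApp (s ∷ ss) ts (suc k , x) z () | inj₁ _
    injectʳ-splitApp (s ∷ ss) ts (suc k , x) .y refl | inj₂ y =
      cong sucᴾ (injectʳ-splitApp ss ts (k , x) y e)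

    tyᴾ-injectˡ : ∀ ss ts y → tyᴾ (ss ++ ts) (injectˡ ss ts y) ≡ tyᴾ ss y
    tyᴾ-injectˡ (s ∷ ss) ts (zero , x)  = refl
    tyᴾ-injectˡ (s ∷ ss) ts (suc k , x) = tyᴾ-injectˡ ss ts (k , x)

    tyᴾ-injectʳ : ∀ ss ts y → tyᴾ (ss ++ ts) (injectʳ ss ts y) ≡ tyᴾ ts y
    tyᴾ-injectʳ []       ts y = refl
    tyᴾ-injectʳ (s ∷ ss) ts y = tyᴾ-injectʳ ss ts y

    injectOuter : ∀ ts i ss (y : P F ts) → False (proj₁ y ≟ᶠ i) → P F (insertAt ts i ss)
    injectOuter (t ∷ ts) zero    ss (zero , x)  ()
    injectOuter (t ∷ ts) zero    ss (suc k , x) k≢i = injectʳ ss ts (k , x)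
    injectOuter (t ∷ ts) (suc i) ss (zero , x)  k≢i = zero , x
    injectOuter (t ∷ ts) (suc i) ss (suc k , x) k≢i = sucᴾ (injectOuter ts i ss (k , x) (False-suc⁻ k≢i))

    injectInner : ∀ ts i ss → P F ss → P F (insertAt ts i ss)
    injectInner (t ∷ ts) zero    ss y = injectˡ ss ts y
    injectInner (t ∷ ts) (suc i) ss y = sucᴾ (injectInner ts i ss y)

    splitIns-injectOuter : ∀ ts i ss y k≢i → splitIns F ts i ss (injectOuter ts i ss y k≢i) ≡ inj₁ y
    splitIns-injectOuter (t ∷ ts) zero    ss (zero , x) ()
    splitIns-injectOuter (t ∷ ts) zero    ss (suc k , x) k≢i rewrite splitApp-injectʳ ss ts (k , x) = refl
    splitIns-injectOuter (t ∷ ts) (suc i) ss (zero , x)  k≢i = refl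
    splitIns-injectOuter (t ∷ ts) (suc i) ss (suc k , x) k≢i
      rewrite splitIns-injectOuter ts i ss (k , x) (False-suc⁻ k≢i) = refl

    splitIns-injectInner : ∀ ts i ss y → splitIns F ts i ss (injectInner ts i ss y) ≡ inj₂ y
    splitIns-injectInner (t ∷ ts) zero    ss y rewrite splitApp-injectˡ ss ts y = refl
    splitIns-injectInner (t ∷ ts) (suc i) ss y rewrite splitIns-injectInner ts i ss y = refl

    splitIns-outer≢ : ∀ ts i ss y z → splitIns F ts i ss y ≡ inj₁ z → False (proj₁ z ≟ᶠ i)
    splitIns-outer≢ (t ∷ ts) zero ss y z eq with splitApp F ss ts y
    splitIns-outer≢ (t ∷ ts) zero ss y z () | inj₁ _
    splitIns-outer≢ (t ∷ ts) zero ss y .(suc j , x) refl | inj₂ (j , x) = tt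
    splitIns-outer≢ (t ∷ ts) (suc i) ss (zero , x) .(zero , x) refl = tt
    splitIns-outer≢ (t ∷ ts) (suc i) ss (suc k , x) z eq with splitIns F ts i ss (k , x) in e
    splitIns-outer≢ (t ∷ ts) (suc i) ss (suc k , x) .(suc j , y) refl | inj₁ (j , y) =
      False-suc (splitIns-outer≢ ts i ss (k , x) (j , y) e)
    splitIns-outer≢ (t ∷ ts) (suc i) ss (suc k , x) z () | inj₂ _

    injectOuter-splitIns : ∀ ts i ss y z → splitIns F ts i ss y ≡ inj₁ z
                           → ∀ k≢i → y ≡ injectOuter ts i ss z k≢i
    injectOuter-splitIns (t ∷ ts) zero ss y z eq k≢i with splitApp F ss ts y in e
    injectOuter-splitIns (t ∷ ts) zero ss y z () k≢i | inj₁ _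
    injectOuter-splitIns (t ∷ ts) zero ss y .(suc j , x) refl k≢i | inj₂ (j , x) =
      injectʳ-splitApp ss ts y (j , x) e
    injectOuter-splitIns (t ∷ ts) (suc i) ss (zero , x) .(zero , x) refl k≢i = refl
    injectOuter-splitIns (t ∷ ts) (suc i) ss (suc k , x) z eq k≢i with splitIns F ts i ss (k , x) in e
    injectOuter-splitIns (t ∷ ts) (suc i) ss (suc k , x) .(suc j , y) refl k≢i | inj₁ (j , y) =
      cong sucᴾ (injectOuter-splitIns ts i ss (k , x) (j , y) e (False-suc⁻ k≢i))
    injectOuter-splitIns (t ∷ ts) (suc i) ss (suc k , x) z () k≢i | inj₂ _

    injectInner-splitIns : ∀ ts i ss y z → splitIns F ts i ss y ≡ inj₂ z → y ≡ injectInner ts i ss z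
    injectInner-splitIns (t ∷ ts) zero ss y z eq with splitApp F ss ts y in e
    injectInner-splitIns (t ∷ ts) zero ss y z refl | inj₁ z = injectˡ-splitApp ss ts y z e
    injectInner-splitIns (t ∷ ts) zero ss y z () | inj₂ _
    injectInner-splitIns (t ∷ ts) (suc i) ss (zero , x) z ()
    injectInner-splitIns (t ∷ ts) (suc i) ss (suc k , x) z eq with splitIns F ts i ss (k , x) in e
    injectInner-splitIns (t ∷ ts) (suc i) ss (suc k , x) z () | inj₁ _
    injectInner-splitIns (t ∷ ts) (suc i) ss (suc k , x) .y refl | inj₂ y =
      cong sucᴾ (injectInner-splitIns ts i ss (k , x) y e)

    splitIns-injective : ∀ ts i ss y y' → splitIns F ts i ss y ≡ splitIns F ts i ss y' → y ≡ y'
    splitIns-injective ts i ss y y' e with splitIns F ts i ss y in e₁ | splitIns F ts i ss y' in e₂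
    ... | inj₁ z | inj₁ z' with refl ← e =
      let k≢i = splitIns-outer≢ ts i ss y z e₁ in
      trans (injectOuter-splitIns ts i ss y z e₁ k≢i) (sym (injectOuter-splitIns ts i ss y' z e₂ k≢i))
    ... | inj₂ z | inj₂ z' with refl ← e =
      trans (injectInner-splitIns ts i ss y z e₁) (sym (injectInner-splitIns ts i ss y' z e₂))
    ... | inj₁ _ | inj₂ _ with () ← e
    ... | inj₂ _ | inj₁ _ with () ← e

    tyᴾ-injectOuter : ∀ ts i ss y k≢i → tyᴾ (insertAt ts i ss) (injectOuter ts i ss y k≢i) ≡ tyᴾ ts y
    tyᴾ-injectOuter (t ∷ ts) zero    ss (zero , x) ()
    tyᴾ-injectOuter (t ∷ ts) zero    ss (suc k , x) k≢i = tyᴾ-injectʳ ss ts (k , x)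
    tyᴾ-injectOuter (t ∷ ts) (suc i) ss (zero , x)  k≢i = refl
    tyᴾ-injectOuter (t ∷ ts) (suc i) ss (suc k , x) k≢i = tyᴾ-injectOuter ts i ss (k , x) (False-suc⁻ k≢i)

    tyᴾ-injectInner : ∀ ts i ss y → tyᴾ (insertAt ts i ss) (injectInner ts i ss y) ≡ tyᴾ ss y
    tyᴾ-injectInner (t ∷ ts) zero    ss y = tyᴾ-injectˡ ss ts y
    tyᴾ-injectInner (t ∷ ts) (suc i) ss y = tyᴾ-injectInner ts i ss y

    tyᴾ-splitIns : ∀ ts i ss y → tyᴾ (insertAt ts i ss) y ≡ [ tyᴾ ts , tyᴾ ss ] (splitIns F ts i ss y)
    tyᴾ-splitIns ts i ss y with splitIns F ts i ss y in e
    ... | inj₁ z = let k≢i = splitIns-outer≢ ts i ss y z e in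
      trans (cong (tyᴾ (insertAt ts i ss)) (injectOuter-splitIns ts i ss y z e k≢i)) (tyᴾ-injectOuter ts i ss z k≢i)
    ... | inj₂ z = trans (cong (tyᴾ (insertAt ts i ss)) (injectInner-splitIns ts i ss y z e)) (tyᴾ-injectInner ts i ss z)

  SrcPorts TgtPorts : List (Box {τ}) → Box → TType
  SrcPorts ts v = ⌊ In v ⌋ ⊕ ⨁Out ts
  TgtPorts ts v = ⨁In ts ⊕ ⌊ Out v ⌋

  connT : ∀ {ts v} (Φ : WD ts v) → TIso (SrcPorts ts v) (TgtPorts ts v)
  connT Φ = tgt Φ ∘ᵗ symᵗ (src Φ)

  conn : ∀ {ts v} (Φ : WD ts v) → Carrier (SrcPorts ts v) → Carrier (TgtPorts ts v)
  conn Φ = app (connT Φ)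

  conn⇒Prec : ∀ {ts v} (Φ : WD ts v) a q b p → conn Φ (inj₂ (a , q)) ≡ inj₁ (b , p)
              → Prec ts v (src Φ) (tgt Φ) a b
  conn⇒Prec Φ a q b p e = app⁻ (src Φ) (inj₂ (a , q)) , (q , app∘app⁻ (src Φ) _) , (p , e)

  module Composition {ts : List (Box {τ})} {v : Box {τ}} {ss : List (Box {τ})} (i : Fin (length ts))
                     (Ψ : WD ss (lookup ts i)) (Φ : WD ts v) where
    open Fuse i Ψ Φ

    afterΨ : Carrier (⨁In ss) ⊎ Elt (Out tᵢ) → TgtFrame
    afterΨ (inj₁ y) = inj₁ (inj₂ y)
    afterΨ (inj₂ q) = liftT (conn Φ (inj₂ (i , q)))

    afterΦ-at : (k : Fin (length ts)) → Elt (In (lookup ts k)) → Dec (k ≡ i) → TgtFrame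
    afterΦ-at k p (yes refl) = afterΨ (conn Ψ (inj₁ p))
    afterΦ-at k p (no _)     = inj₁ (inj₁ (k , p))

    afterΦ : Carrier (⨁In ts) ⊎ Elt (Out v) → TgtFrame
    afterΦ (inj₁ (k , p)) = afterΦ-at k p (k ≟ᶠ i)
    afterΦ (inj₂ z)       = inj₂ z

    -- The connection map of Ψ ;ᵢ Φ: follow Φ (or Ψ), and switch diagram each time
    -- the wire reaches box i; by progress this happens at most twice.
    fusedConn : SrcFrame → TgtFrame
    fusedConn (inj₁ x)        = afterΦ (conn Φ (inj₁ x))
    fusedConn (inj₂ (inj₁ z)) = afterΦ (conn Φ (inj₂ z))
    fusedConn (inj₂ (inj₂ x)) = afterΨ (conn Ψ (inj₂ x))

    record FusedWire (s : SrcFrame) (t : TgtFrame) : Set where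
      constructor fusedWire
      field
        wire     : Fused
        wire-src : fusedSrc wire ≡ s
        wire-tgt : fusedTgt wire ≡ t
    open FusedWire

    no-loop-at-i : ∀ (a : WΦ) q p → srcF Φ a ≡ inj₂ (i , q) → tgtF Φ a ≡ inj₁ (i , p) → ⊥
    no-loop-at-i a q p e₁ e₂ = progress Φ i (one (a , (q , e₁) , (p , e₂)))

    offIn-leaving-i : (a : WΦ) (q : Elt (Out tᵢ)) → srcF Φ a ≡ inj₂ (i , q) → OffIn (tgtF Φ a)
    offIn-leaving-i a q e with tgtF Φ a in e'
    ... | inj₂ _ = tt
    ... | inj₁ (k , p) with k ≟ᶠ i
    ...   | no _     = tt
    ...   | yes refl = ⊥-elim (no-loop-at-i a q p e e')

    through-i : (a : WΦ) (p : Elt (In tᵢ)) → tgtF Φ a ≡ inj₁ (i , p) → OffOut (srcF Φ a)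
                → (b : WΨ) → srcF Ψ b ≡ inj₁ p → FusedWire (liftS (srcF Φ a)) (afterΨ (tgtF Ψ b))
    through-i a p e₁ o b e₂ with tgtF Ψ b in e₃
    ... | inj₁ y = fusedWire (fI a b p y e₁ e₂ e₃ o) refl refl
    ... | inj₂ q = fusedWire (fII' a b a' p q e₁ e₂ e₃ e₄ o (offIn-leaving-i a' q e₄)) refl refl
      where a' = app⁻ (src Φ) (inj₂ (i , q))
            e₄ = app∘app⁻ (src Φ) (inj₂ (i , q))

    alongΦ : (a : WΦ) → OffOut (srcF Φ a) → FusedWire (liftS (srcF Φ a)) (afterΦ (tgtF Φ a))
    alongΦ a o with tgtF Φ a in e
    ... | inj₂ y = fusedWire (fII a o (subst OffIn (sym e) tt)) refl (cong liftT e)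
    ... | inj₁ (k , p) with k ≟ᶠ i
    ...   | no k≢i   = fusedWire (fII a o (subst OffIn (sym e) (fromWitnessFalse k≢i))) refl (cong liftT e)
    ...   | yes refl = through-i a p e o (app⁻ (src Ψ) (inj₁ p)) (app∘app⁻ (src Ψ) (inj₁ p))

    alongΨ : (b : WΨ) (x : Carrier (⨁Out ss)) → srcF Ψ b ≡ inj₂ x
             → FusedWire (inj₂ (inj₂ x)) (afterΨ (tgtF Ψ b))
    alongΨ b x e with tgtF Ψ b in e₃
    ... | inj₁ y = fusedWire (fIII b x y e e₃) refl refl
    ... | inj₂ q = fusedWire (fIV b a' x q e e₃ e₄ (offIn-leaving-i a' q e₄)) refl refl
      where a' = app⁻ (src Φ) (inj₂ (i , q))
            e₄ = app∘app⁻ (src Φ) (inj₂ (i , q))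

    trace-outer : (z : Carrier (SrcPorts ts v)) → OffOut z → FusedWire (liftS z) (afterΦ (conn Φ z))
    trace-outer z o = subst (λ s → FusedWire s (afterΦ (conn Φ z))) (cong liftS (app∘app⁻ (src Φ) z))
                        (alongΦ (app⁻ (src Φ) z) (subst OffOut (sym (app∘app⁻ (src Φ) z)) o))

    trace-inner : (x : Carrier (⨁Out ss)) → FusedWire (inj₂ (inj₂ x)) (afterΨ (conn Ψ (inj₂ x)))
    trace-inner x = alongΨ (app⁻ (src Ψ) (inj₂ x)) x (app∘app⁻ (src Ψ) (inj₂ x))

    trace : (x : Carrier (SrcPorts (insertAt ts i ss) v)) → FusedWire (splitSrc x) (fusedConn (splitSrc x))
    trace (inj₁ x) = trace-outer (inj₁ x) tt
    trace (inj₂ y) with splitIns Out ts i ss y in e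
    ... | inj₁ z = trace-outer (inj₂ z) (splitIns-outer≢ Out ts i ss y z e)
    ... | inj₂ x = trace-inner x

    unsplitSrc : (z : Carrier (SrcPorts ts v)) → OffOut z → Carrier (SrcPorts (insertAt ts i ss) v)
    unsplitSrc (inj₁ x) _ = inj₁ x
    unsplitSrc (inj₂ y) o = inj₂ (injectOuter Out ts i ss y o)

    fusedSrcPort : Fused → Carrier (SrcPorts (insertAt ts i ss) v)
    fusedSrcPort (fI a _ _ _ _ _ _ o)         = unsplitSrc (srcF Φ a) o
    fusedSrcPort (fII a o _)                  = unsplitSrc (srcF Φ a) o
    fusedSrcPort (fII' a _ _ _ _ _ _ _ _ o _) = unsplitSrc (srcF Φ a) o
    fusedSrcPort (fIII _ x _ _ _)             = inj₂ (injectInner Out ts i ss x)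
    fusedSrcPort (fIV _ _ x _ _ _ _ _)        = inj₂ (injectInner Out ts i ss x)

    splitSrc-unsplitSrc : ∀ z o → splitSrc (unsplitSrc z o) ≡ liftS z
    splitSrc-unsplitSrc (inj₁ x) o = refl
    splitSrc-unsplitSrc (inj₂ y) o = cong inj₂ (splitIns-injectOuter Out ts i ss y o)

    splitSrc-fusedSrcPort : ∀ f → splitSrc (fusedSrcPort f) ≡ fusedSrc f
    splitSrc-fusedSrcPort (fI a _ _ _ _ _ _ o)         = splitSrc-unsplitSrc (srcF Φ a) o
    splitSrc-fusedSrcPort (fII a o _)                  = splitSrc-unsplitSrc (srcF Φ a) o
    splitSrc-fusedSrcPort (fII' a _ _ _ _ _ _ _ _ o _) = splitSrc-unsplitSrc (srcF Φ a) o
    splitSrc-fusedSrcPort (fIII _ x _ _ _)             = cong inj₂ (splitIns-injectInner Out ts i ss x)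
    splitSrc-fusedSrcPort (fIV _ _ x _ _ _ _ _)        = cong inj₂ (splitIns-injectInner Out ts i ss x)

    splitSrc-injective : ∀ x x' → splitSrc x ≡ splitSrc x' → x ≡ x'
    splitSrc-injective (inj₁ x) (inj₁ .x) refl = refl
    splitSrc-injective (inj₂ y) (inj₂ y') e = cong inj₂ (splitIns-injective Out ts i ss y y' (inj₂-injective e))
    splitSrc-injective (inj₁ x) (inj₂ y) ()
    splitSrc-injective (inj₂ y) (inj₁ x) ()

    liftS-injective : ∀ {z z'} → liftS z ≡ liftS z' → z ≡ z'
    liftS-injective {inj₁ _} {inj₁ _} refl = refl
    liftS-injective {inj₂ _} {inj₂ _} refl = refl

    liftS≢inner : ∀ {z x} → liftS z ≡ inj₂ (inj₂ x) → ⊥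
    liftS≢inner {inj₁ _} ()
    liftS≢inner {inj₂ _} ()

    OffOut-irrelevant : ∀ z (o o' : OffOut z) → o ≡ o'
    OffOut-irrelevant (inj₁ _)       o o' = refl
    OffOut-irrelevant (inj₂ (k , _)) o o' = T-irrelevant o o'

    OffIn-irrelevant : ∀ z (o o' : OffIn z) → o ≡ o'
    OffIn-irrelevant (inj₁ (k , _)) o o' = T-irrelevant o o'
    OffIn-irrelevant (inj₂ _)       o o' = refl

    srcΦ-injective : ∀ {a a'} → srcF Φ a ≡ srcF Φ a' → a ≡ a'
    srcΦ-injective = app-injective (src Φ)

    srcΨ-injective : ∀ {b b'} → srcF Ψ b ≡ srcF Ψ b' → b ≡ b'
    srcΨ-injective = app-injective (src Ψ)

    entering-i-not-offIn : ∀ {a p} → tgtF Φ a ≡ inj₁ (i , p) → OffIn (tgtF Φ a) → ⊥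
    entering-i-not-offIn e o = toWitnessFalse (subst OffIn e o) refl

    fI-unique : ∀ a b p y e₁ e₂ e₃ o f
                → fusedSrc (fI a b p y e₁ e₂ e₃ o) ≡ fusedSrc f → fI a b p y e₁ e₂ e₃ o ≡ f
    fI-unique a b p y e₁ e₂ e₃ o (fI a' b' p' y' e₁' e₂' e₃' o') e
      with refl ← srcΦ-injective (liftS-injective e)
      with refl ← trans (sym e₁) e₁'
      with refl ← srcΨ-injective (trans e₂ (sym e₂'))
      with refl ← trans (sym e₃) e₃'
      with refl ← uip e₁ e₁' | refl ← uip e₂ e₂' | refl ← uip e₃ e₃'
      with refl ← OffOut-irrelevant (srcF Φ a) o o' = refl
    fI-unique a b p y e₁ e₂ e₃ o (fII a' o' oi) e
      with refl ← srcΦ-injective (liftS-injective e) = ⊥-elim (entering-i-not-offIn e₁ oi)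
    fI-unique a b p y e₁ e₂ e₃ o (fII' a' b' a'' p' q' e₁' e₂' e₃' e₄' o' oi') e
      with refl ← srcΦ-injective (liftS-injective e)
      with refl ← trans (sym e₁) e₁'
      with refl ← srcΨ-injective (trans e₂ (sym e₂'))
      with () ← trans (sym e₃) e₃'
    fI-unique a b p y e₁ e₂ e₃ o (fIII _ _ _ _ _) e        = ⊥-elim (liftS≢inner e)
    fI-unique a b p y e₁ e₂ e₃ o (fIV _ _ _ _ _ _ _ _) e   = ⊥-elim (liftS≢inner e)

    fII-unique : ∀ a o oi f → fusedSrc (fII a o oi) ≡ fusedSrc f → fII a o oi ≡ f
    fII-unique a o oi (fI a' b' p' y' e₁' e₂' e₃' o') e
      with refl ← srcΦ-injective (liftS-injective e) = ⊥-elim (entering-i-not-offIn e₁' oi)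
    fII-unique a o oi (fII a' o' oi') e
      with refl ← srcΦ-injective (liftS-injective e)
      with refl ← OffOut-irrelevant (srcF Φ a) o o'
      with refl ← OffIn-irrelevant (tgtF Φ a) oi oi' = refl
    fII-unique a o oi (fII' a' b' a'' p' q' e₁' e₂' e₃' e₄' o' oi') e
      with refl ← srcΦ-injective (liftS-injective e) = ⊥-elim (entering-i-not-offIn e₁' oi)
    fII-unique a o oi (fIII _ _ _ _ _) e      = ⊥-elim (liftS≢inner e)
    fII-unique a o oi (fIV _ _ _ _ _ _ _ _) e = ⊥-elim (liftS≢inner e)

    fII'-unique : ∀ a b a₁ p q e₁ e₂ e₃ e₄ o oi f
                  → fusedSrc (fII' a b a₁ p q e₁ e₂ e₃ e₄ o oi) ≡ fusedSrc f
                  → fII' a b a₁ p q e₁ e₂ e₃ e₄ o oi ≡ f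
    fII'-unique a b a₁ p q e₁ e₂ e₃ e₄ o oi (fI a' b' p' y' e₁' e₂' e₃' o') e
      with refl ← srcΦ-injective (liftS-injective e)
      with refl ← trans (sym e₁) e₁'
      with refl ← srcΨ-injective (trans e₂ (sym e₂'))
      with () ← trans (sym e₃) e₃'
    fII'-unique a b a₁ p q e₁ e₂ e₃ e₄ o oi (fII a' o' oi') e
      with refl ← srcΦ-injective (liftS-injective e) = ⊥-elim (entering-i-not-offIn e₁ oi')
    fII'-unique a b a₁ p q e₁ e₂ e₃ e₄ o oi (fII' a' b' a₁' p' q' e₁' e₂' e₃' e₄' o' oi') e
      with refl ← srcΦ-injective (liftS-injective e)
      with refl ← trans (sym e₁) e₁'
      with refl ← srcΨ-injective (trans e₂ (sym e₂'))
      with refl ← trans (sym e₃) e₃'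
      with refl ← srcΦ-injective (trans e₄ (sym e₄'))
      with refl ← uip e₁ e₁' | refl ← uip e₂ e₂' | refl ← uip e₃ e₃' | refl ← uip e₄ e₄'
      with refl ← OffOut-irrelevant (srcF Φ a) o o'
      with refl ← OffIn-irrelevant (tgtF Φ a₁) oi oi' = refl
    fII'-unique a b a₁ p q e₁ e₂ e₃ e₄ o oi (fIII _ _ _ _ _) e      = ⊥-elim (liftS≢inner e)
    fII'-unique a b a₁ p q e₁ e₂ e₃ e₄ o oi (fIV _ _ _ _ _ _ _ _) e = ⊥-elim (liftS≢inner e)

    fIII-unique : ∀ b x y e₁ e₂ f → fusedSrc (fIII b x y e₁ e₂) ≡ fusedSrc f → fIII b x y e₁ e₂ ≡ f
    fIII-unique b x y e₁ e₂ (fI _ _ _ _ _ _ _ _) e                = ⊥-elim (liftS≢inner (sym e))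
    fIII-unique b x y e₁ e₂ (fII _ _ _) e                         = ⊥-elim (liftS≢inner (sym e))
    fIII-unique b x y e₁ e₂ (fII' _ _ _ _ _ _ _ _ _ _ _) e        = ⊥-elim (liftS≢inner (sym e))
    fIII-unique b x y e₁ e₂ (fIII b' x' y' e₁' e₂') refl
      with refl ← srcΨ-injective (trans e₁ (sym e₁'))
      with refl ← trans (sym e₂) e₂'
      with refl ← uip e₁ e₁' | refl ← uip e₂ e₂' = refl
    fIII-unique b x y e₁ e₂ (fIV b' a' x' q' e₁' e₂' e₃' oi') refl
      with refl ← srcΨ-injective (trans e₁ (sym e₁'))
      with () ← trans (sym e₂) e₂'

    fIV-unique : ∀ b a x q e₁ e₂ e₃ oi f
                 → fusedSrc (fIV b a x q e₁ e₂ e₃ oi) ≡ fusedSrc f → fIV b a x q e₁ e₂ e₃ oi ≡ f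
    fIV-unique b a x q e₁ e₂ e₃ oi (fI _ _ _ _ _ _ _ _) e         = ⊥-elim (liftS≢inner (sym e))
    fIV-unique b a x q e₁ e₂ e₃ oi (fII _ _ _) e                  = ⊥-elim (liftS≢inner (sym e))
    fIV-unique b a x q e₁ e₂ e₃ oi (fII' _ _ _ _ _ _ _ _ _ _ _) e = ⊥-elim (liftS≢inner (sym e))
    fIV-unique b a x q e₁ e₂ e₃ oi (fIII b' x' y' e₁' e₂') refl
      with refl ← srcΨ-injective (trans e₁ (sym e₁'))
      with () ← trans (sym e₂) e₂'
    fIV-unique b a x q e₁ e₂ e₃ oi (fIV b' a' x' q' e₁' e₂' e₃' oi') refl
      with refl ← srcΨ-injective (trans e₁ (sym e₁'))
      with refl ← trans (sym e₂) e₂'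
      with refl ← srcΦ-injective (trans e₃ (sym e₃'))
      with refl ← uip e₁ e₁' | refl ← uip e₂ e₂' | refl ← uip e₃ e₃'
      with refl ← OffIn-irrelevant (tgtF Φ a) oi oi' = refl

    fusedSrc-injective : ∀ f f' → fusedSrc f ≡ fusedSrc f' → f ≡ f'
    fusedSrc-injective (fI a b p y e₁ e₂ e₃ o)              = fI-unique a b p y e₁ e₂ e₃ o
    fusedSrc-injective (fII a o oi)                         = fII-unique a o oi
    fusedSrc-injective (fII' a b a₁ p q e₁ e₂ e₃ e₄ o oi)   = fII'-unique a b a₁ p q e₁ e₂ e₃ e₄ o oi
    fusedSrc-injective (fIII b x y e₁ e₂)                   = fIII-unique b x y e₁ e₂
    fusedSrc-injective (fIV b a x q e₁ e₂ e₃ oi)            = fIV-unique b a x q e₁ e₂ e₃ oi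

    tySrcFrame : SrcFrame → τ
    tySrcFrame = [ tyₛ (In v) , [ tyᴾ Out ts , tyᴾ Out ss ] ]

    ty-splitSrc : ∀ x → ty (SrcPorts (insertAt ts i ss) v) x ≡ tySrcFrame (splitSrc x)
    ty-splitSrc (inj₁ x) = refl
    ty-splitSrc (inj₂ y) = tyᴾ-splitIns Out ts i ss y

    ty-liftS : ∀ z → tySrcFrame (liftS z) ≡ ty (SrcPorts ts v) z
    ty-liftS (inj₁ x) = refl
    ty-liftS (inj₂ y) = refl

    ty-fusedSrc : ∀ f → tySrcFrame (fusedSrc f) ≡ ty FusedT f
    ty-fusedSrc (fI a _ _ _ _ _ _ _)         = trans (ty-liftS (srcF Φ a)) (pres (src Φ) a)
    ty-fusedSrc (fII a _ _)                  = trans (ty-liftS (srcF Φ a)) (pres (src Φ) a)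
    ty-fusedSrc (fII' a _ _ _ _ _ _ _ _ _ _) = trans (ty-liftS (srcF Φ a)) (pres (src Φ) a)
    ty-fusedSrc (fIII b x _ e _)             = trans (sym (cong (ty (SrcPorts ss tᵢ)) e)) (pres (src Ψ) b)
    ty-fusedSrc (fIV b _ x _ e _ _ _)        = trans (sym (cong (ty (SrcPorts ss tᵢ)) e)) (pres (src Ψ) b)

    module _ (Θ : WD (insertAt ts i ss) v)
             (agrees : ∀ x → splitTgt (conn Θ x) ≡ fusedConn (splitSrc x)) where

      toFused : Elt (wires Θ) → Fused
      toFused w = wire (trace (srcF Θ w))

      fromFused : Fused → Elt (wires Θ)
      fromFused f = app⁻ (src Θ) (fusedSrcPort f)

      toFused∘fromFused : ∀ f → toFused (fromFused f) ≡ f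
      toFused∘fromFused f = fusedSrc-injective _ _
        (trans (wire-src (trace (srcF Θ (fromFused f))))
        (trans (cong splitSrc (app∘app⁻ (src Θ) (fusedSrcPort f))) (splitSrc-fusedSrcPort f)))

      fromFused∘toFused : ∀ w → fromFused (toFused w) ≡ w
      fromFused∘toFused w =
        trans (cong (app⁻ (src Θ)) (splitSrc-injective _ _
                (trans (splitSrc-fusedSrcPort (toFused w)) (wire-src (trace (srcF Θ w))))))
              (app⁻∘app (src Θ) w)

      ty-toFused : ∀ w → ty FusedT (toFused w) ≡ tyₛ (wires Θ) w
      ty-toFused w = trans (sym (ty-fusedSrc (toFused w)))
                    (trans (cong tySrcFrame (wire-src (trace (srcF Θ w))))
                    (trans (sym (ty-splitSrc (srcF Θ w))) (pres (src Θ) w)))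

      isComposite : IsComposite i Ψ Φ Θ
      isComposite = record
        { fuse    = mkTIso toFused fromFused toFused∘fromFused fromFused∘toFused ty-toFused
        ; src-com = λ w → sym (wire-src (trace (srcF Θ w)))
        ; tgt-com = λ w → trans (cong (splitTgt ∘ tgtF Θ) (sym (app⁻∘app (src Θ) w)))
                           (trans (agrees (srcF Θ w)) (sym (wire-tgt (trace (srcF Θ w))))) }

  ConnAgrees : ∀ {ts v ss} (i : Fin (length ts)) (Ψ : WD {τ} ss (lookup ts i)) (Φ : WD ts v)
               (Θ : WD (insertAt ts i ss) v) → Set
  ConnAgrees i Ψ Φ Θ = ∀ x → Fuse.splitTgt i Ψ Φ (conn Θ x) ≡ Composition.fusedConn i Ψ Φ (Fuse.splitSrc i Ψ Φ x)

  isComposite-byConn : ∀ {ts v ss} (i : Fin (length ts)) (Ψ : WD {τ} ss (lookup ts i)) (Φ : WD ts v)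
                       (Θ : WD (insertAt ts i ss) v) → ConnAgrees i Ψ Φ Θ → IsComposite i Ψ Φ Θ
  isComposite-byConn i Ψ Φ = Composition.isComposite i Ψ Φ

  module _ (F : Box {τ} → TSet {τ}) where

    sizeᴾ : List (Box {τ}) → ℕ
    sizeᴾ []       = 0
    sizeᴾ (t ∷ ts) = size (F t) + sizeᴾ ts

    P-cons : ∀ t ts → P F (t ∷ ts) ↔ (Elt (F t) ⊎ P F ts)
    P-cons t ts = mk↔ₛ′ to from to∘from from∘to
      where
      to : P F (t ∷ ts) → Elt (F t) ⊎ P F ts
      to (zero , x)  = inj₁ x
      to (suc k , x) = inj₂ (k , x)
      from : Elt (F t) ⊎ P F ts → P F (t ∷ ts)
      from (inj₁ x)       = zero , x
      from (inj₂ (k , x)) = suc k , x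
      to∘from : ∀ y → to (from y) ≡ y
      to∘from (inj₁ x)       = refl
      to∘from (inj₂ (k , x)) = refl
      from∘to : ∀ y → from (to y) ≡ y
      from∘to (zero , x)  = refl
      from∘to (suc k , x) = refl

    enumᴾ : ∀ ts → P F ts ↔ Fin (sizeᴾ ts)
    enumᴾ []       = mk↔ₛ′ (λ { (() , _) }) (λ ()) (λ ()) (λ { (() , _) })
    enumᴾ (t ∷ ts) = ↔-trans (P-cons t ts) (↔-trans (enum (F t) ⊎-↔ enumᴾ ts) (↔-sym +↔⊎))

    PortSet : List (Box {τ}) → TSet {τ}
    PortSet ts = record { Elt = P F ts ; tyₛ = tyᴾ F ts ; size = sizeᴾ ts ; enum = enumᴾ ts }

  srcPortSet : List (Box {τ}) → Box → TSet
  srcPortSet ts v = In v ⊕ₛ PortSet Out ts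

  srcPortSet≅SrcPorts : ∀ ts v → TIso ⌊ srcPortSet ts v ⌋ (SrcPorts ts v)
  srcPortSet≅SrcPorts ts v = mkTIso id id (λ _ → refl) (λ _ → refl) (λ { (inj₁ _) → refl ; (inj₂ _) → refl })

  -- the wires are named by their sources
  fromConn : ∀ {ts v} (c : TIso (SrcPorts ts v) (TgtPorts ts v))
             → (∀ k → ¬ TransClosure (Prec ts v (srcPortSet≅SrcPorts ts v) (c ∘ᵗ srcPortSet≅SrcPorts ts v)) k k)
             → WD ts v
  fromConn {ts} {v} c acyclic = record
    { wires = srcPortSet ts v ; src = srcPortSet≅SrcPorts ts v ; tgt = c ∘ᵗ srcPortSet≅SrcPorts ts v
    ; progress = acyclic }

  Forward : ∀ {ts v} → TIso (SrcPorts ts v) (TgtPorts ts v) → Set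
  Forward {ts} c = ∀ (i j : Fin (length ts)) q p → app c (inj₂ (i , q)) ≡ inj₁ (j , p) → toℕ i < toℕ j

  fromForwardConn : ∀ {ts v} (c : TIso (SrcPorts ts v) (TgtPorts ts v)) → Forward {ts} {v} c → WD ts v
  fromForwardConn {ts} {v} c forward =
    fromConn {ts} {v} c (λ k cycle → <-irrefl refl (transitive⁻ _<_ <-trans (tc-map toℕ step cycle)))
    where
    step : ∀ {i j} → Prec ts v (srcPortSet≅SrcPorts ts v) (c ∘ᵗ srcPortSet≅SrcPorts ts v) i j → toℕ i < toℕ j
    step {i} {j} (.(inj₂ (i , q)) , (q , refl) , (p , e)) = forward i j q p e

  module _ {ts ts' : List (Box {τ})} {v v' : Box {τ}} (σ : Fin (length ts) → Fin (length ts'))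
           (βs : ∀ k → BoxIso (lookup ts k) (lookup ts' (σ k))) (β : BoxIso v v') where

    relabelSrc : Carrier (SrcPorts ts v) → Carrier (SrcPorts ts' v')
    relabelSrc (inj₁ x)       = inj₁ (app (isoIn β) x)
    relabelSrc (inj₂ (k , q)) = inj₂ (σ k , app (isoOut (βs k)) q)

    relabelTgt : Carrier (TgtPorts ts v) → Carrier (TgtPorts ts' v')
    relabelTgt (inj₁ (k , p)) = inj₁ (σ k , app (isoIn (βs k)) p)
    relabelTgt (inj₂ y)       = inj₂ (app (isoOut β) y)

    ConnRelabels : WD ts v → WD ts' v' → TIso (SrcPorts ts v) (SrcPorts ts' v') → Set
    ConnRelabels Φ Ψ B = ∀ x → conn Ψ (app B x) ≡ relabelTgt (conn Φ x)

    iso-byConn : (Φ : WD ts v) (Ψ : WD ts' v') (B : TIso (SrcPorts ts v) (SrcPorts ts' v'))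
                 → app B ≗ relabelSrc → ConnRelabels Φ Ψ B → Iso[ σ , βs , β ] Φ Ψ
    iso-byConn Φ Ψ B B≗relabel relabels = record
      { wiso = symᵗ (src Ψ) ∘ᵗ (B ∘ᵗ src Φ) ; src-com = src-com ; tgt-com = tgt-com }
      where
      src-com : ∀ w → srcF Ψ (app⁻ (src Ψ) (app B (srcF Φ w)))
                      ≡ [ (λ x → inj₁ (app (isoIn β) x))
                        , (λ kq → inj₂ (σ (proj₁ kq) , app (isoOut (βs (proj₁ kq))) (proj₂ kq))) ] (srcF Φ w)
      src-com w with srcF Φ w | app∘app⁻ (src Ψ) (app B (srcF Φ w)) | B≗relabel (srcF Φ w)
      ... | inj₁ x | e | e' = trans e e'
      ... | inj₂ y | e | e' = trans e e'
      tgt-com : ∀ w → conn Ψ (app B (srcF Φ w))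
                      ≡ [ (λ kp → inj₁ (σ (proj₁ kp) , app (isoIn (βs (proj₁ kp))) (proj₂ kp)))
                        , (λ y → inj₂ (app (isoOut β) y)) ] (tgtF Φ w)
      tgt-com w with tgtF Φ w | trans (relabels (srcF Φ w)) (cong (relabelTgt ∘ tgtF Φ) (app⁻∘app (src Φ) w))
      ... | inj₁ y | e = e
      ... | inj₂ y | e = e

  ≈-refl : ∀ {ts v} (Φ : WD ts v) → Φ ≈ Φ
  ≈-refl {ts} {v} Φ =
    iso-byConn id (idBoxes {τ} {ts}) idBox Φ Φ (mkTIso id id (λ _ → refl) (λ _ → refl) (λ _ → refl))
      (λ { (inj₁ _) → refl ; (inj₂ _) → refl }) relabels
    where
    relabels : ConnRelabels id (idBoxes {τ} {ts}) idBox Φ Φ (mkTIso id id (λ _ → refl) (λ _ → refl) (λ _ → refl))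
    relabels x with conn Φ x
    ... | inj₁ _ = refl
    ... | inj₂ _ = refl

  seqUnital : SeqUnital {τ}
  seqUnital A B = isComposite-byConn zero (unitWD A) (seqWD A A B) (idWD (box A B)) unitˡ
                , isComposite-byConn (suc zero) (unitWD B) (seqWD A B B) (idWD (box A B)) unitʳ
    where
    unitˡ : ConnAgrees zero (unitWD A) (seqWD A A B) (idWD (box A B))
    unitˡ (inj₁ a)          = refl
    unitˡ (inj₂ (zero , b)) = refl
    unitʳ : ConnAgrees (suc zero) (unitWD B) (seqWD A B B) (idWD (box A B))
    unitʳ (inj₁ a)          = refl
    unitʳ (inj₂ (zero , b)) = refl

  module SeqAssoc (A B C D : TSet {τ}) where
    boxes : List (Box {τ})
    boxes = box A B ∷ box B C ∷ box C D ∷ []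

    connection : TIso (SrcPorts boxes (box A D)) (TgtPorts boxes (box A D))
    connection = mkTIso to from to∘from from∘to to-ty
      where
      to : Carrier (SrcPorts boxes (box A D)) → Carrier (TgtPorts boxes (box A D))
      to (inj₁ a)                  = inj₁ (zero , a)
      to (inj₂ (zero , b))         = inj₁ (suc zero , b)
      to (inj₂ (suc zero , c))     = inj₁ (suc (suc zero) , c)
      to (inj₂ (suc (suc zero) , d)) = inj₂ d
      from : Carrier (TgtPorts boxes (box A D)) → Carrier (SrcPorts boxes (box A D))
      from (inj₁ (zero , a))           = inj₁ a
      from (inj₁ (suc zero , b))       = inj₂ (zero , b)
      from (inj₁ (suc (suc zero) , c)) = inj₂ (suc zero , c)
      from (inj₂ d)                    = inj₂ (suc (suc zero) , d)
      to∘from : ∀ y → to (from y) ≡ y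
      to∘from (inj₁ (zero , a))           = refl
      to∘from (inj₁ (suc zero , b))       = refl
      to∘from (inj₁ (suc (suc zero) , c)) = refl
      to∘from (inj₂ d)                    = refl
      from∘to : ∀ x → from (to x) ≡ x
      from∘to (inj₁ a)                    = refl
      from∘to (inj₂ (zero , b))           = refl
      from∘to (inj₂ (suc zero , c))       = refl
      from∘to (inj₂ (suc (suc zero) , d)) = refl
      to-ty : ∀ x → ty (TgtPorts boxes (box A D)) (to x) ≡ ty (SrcPorts boxes (box A D)) x
      to-ty (inj₁ a)                    = refl
      to-ty (inj₂ (zero , b))           = refl
      to-ty (inj₂ (suc zero , c))       = refl
      to-ty (inj₂ (suc (suc zero) , d)) = refl

    forward : Forward {boxes} {box A D} connection
    forward zero             .(suc zero)       q .q refl = s≤s z≤n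
    forward (suc zero)       .(suc (suc zero)) q .q refl = s≤s (s≤s z≤n)
    forward (suc (suc zero)) j q p ()

    diagram : WD boxes (box A D)
    diagram = fromForwardConn connection forward

    agrees₁ : ConnAgrees (suc zero) (seqWD B C D) (seqWD A B D) diagram
    agrees₁ (inj₁ a)                    = refl
    agrees₁ (inj₂ (zero , b))           = refl
    agrees₁ (inj₂ (suc zero , c))       = refl
    agrees₁ (inj₂ (suc (suc zero) , d)) = refl

    agrees₀ : ConnAgrees zero (seqWD A B C) (seqWD A C D) diagram
    agrees₀ (inj₁ a)                    = refl
    agrees₀ (inj₂ (zero , b))           = refl
    agrees₀ (inj₂ (suc zero , c))       = refl
    agrees₀ (inj₂ (suc (suc zero) , d)) = refl

  seqAssoc : SeqAssoc {τ}
  seqAssoc A B C D = diagram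
                   , isComposite-byConn (suc zero) (seqWD B C D) (seqWD A B D) diagram agrees₁
                   , isComposite-byConn zero (seqWD A B C) (seqWD A C D) diagram agrees₀
    where open SeqAssoc A B C D

  module ParaUnitalˡ (A B : TSet {τ}) where
    outer : Box {τ}
    outer = box (∅ ⊕ₛ A) (∅ ⊕ₛ B)

    connection : TIso (SrcPorts (box A B ∷ []) outer) (TgtPorts (box A B ∷ []) outer)
    connection = mkTIso to from to∘from from∘to to-ty
      where
      to : Carrier (SrcPorts (box A B ∷ []) outer) → Carrier (TgtPorts (box A B ∷ []) outer)
      to (inj₁ (inj₂ a))   = inj₁ (zero , a)
      to (inj₂ (zero , b)) = inj₂ (inj₂ b)
      from : Carrier (TgtPorts (box A B ∷ []) outer) → Carrier (SrcPorts (box A B ∷ []) outer)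
      from (inj₁ (zero , a)) = inj₁ (inj₂ a)
      from (inj₂ (inj₂ b))   = inj₂ (zero , b)
      to∘from : ∀ y → to (from y) ≡ y
      to∘from (inj₁ (zero , a)) = refl
      to∘from (inj₂ (inj₂ b))   = refl
      from∘to : ∀ x → from (to x) ≡ x
      from∘to (inj₁ (inj₂ a))   = refl
      from∘to (inj₂ (zero , b)) = refl
      to-ty : ∀ x → ty (TgtPorts (box A B ∷ []) outer) (to x) ≡ ty (SrcPorts (box A B ∷ []) outer) x
      to-ty (inj₁ (inj₂ a))   = refl
      to-ty (inj₂ (zero , b)) = refl

    diagram : WD (box A B ∷ []) outer
    diagram = fromForwardConn connection (λ { zero j q p () })

    unitors : BoxIso outer (box A B)
    unitors = record { isoIn = ⊕-unitˡ A ; isoOut = ⊕-unitˡ B }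

    unitorSrc : TIso (SrcPorts (box A B ∷ []) outer) (SrcPorts (box A B ∷ []) (box A B))
    unitorSrc = mkTIso to from (λ { (inj₁ _) → refl ; (inj₂ (zero , _)) → refl })
                               (λ { (inj₁ (inj₂ _)) → refl ; (inj₂ (zero , _)) → refl })
                               (λ { (inj₁ (inj₂ _)) → refl ; (inj₂ (zero , _)) → refl })
      where
      to : Carrier (SrcPorts (box A B ∷ []) outer) → Carrier (SrcPorts (box A B ∷ []) (box A B))
      to (inj₁ (inj₂ a)) = inj₁ a
      to (inj₂ y)        = inj₂ y
      from : Carrier (SrcPorts (box A B ∷ []) (box A B)) → Carrier (SrcPorts (box A B ∷ []) outer)
      from (inj₁ a) = inj₁ (inj₂ a)
      from (inj₂ y) = inj₂ y

    agrees : ConnAgrees zero (unitWD ∅) (paraWD ∅ A ∅ B) diagram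
    agrees (inj₁ (inj₂ a))   = refl
    agrees (inj₂ (zero , b)) = refl

    relabels : ConnRelabels id (idBoxes {τ} {box A B ∷ []}) unitors diagram (idWD (box A B)) unitorSrc
    relabels (inj₁ (inj₂ a))   = refl
    relabels (inj₂ (zero , b)) = refl

    diagram≈id : diagram ≈[ unitors ] idWD (box A B)
    diagram≈id = iso-byConn id (idBoxes {τ} {box A B ∷ []}) unitors diagram (idWD (box A B)) unitorSrc
                   (λ { (inj₁ (inj₂ _)) → refl ; (inj₂ (zero , _)) → refl }) relabels

  module ParaUnitalʳ (A B : TSet {τ}) where
    outer : Box {τ}
    outer = box (A ⊕ₛ ∅) (B ⊕ₛ ∅)

    connection : TIso (SrcPorts (box A B ∷ []) outer) (TgtPorts (box A B ∷ []) outer)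
    connection = mkTIso to from to∘from from∘to to-ty
      where
      to : Carrier (SrcPorts (box A B ∷ []) outer) → Carrier (TgtPorts (box A B ∷ []) outer)
      to (inj₁ (inj₁ a))   = inj₁ (zero , a)
      to (inj₂ (zero , b)) = inj₂ (inj₁ b)
      from : Carrier (TgtPorts (box A B ∷ []) outer) → Carrier (SrcPorts (box A B ∷ []) outer)
      from (inj₁ (zero , a)) = inj₁ (inj₁ a)
      from (inj₂ (inj₁ b))   = inj₂ (zero , b)
      to∘from : ∀ y → to (from y) ≡ y
      to∘from (inj₁ (zero , a)) = refl
      to∘from (inj₂ (inj₁ b))   = refl
      from∘to : ∀ x → from (to x) ≡ x
      from∘to (inj₁ (inj₁ a))   = refl
      from∘to (inj₂ (zero , b)) = refl
      to-ty : ∀ x → ty (TgtPorts (box A B ∷ []) outer) (to x) ≡ ty (SrcPorts (box A B ∷ []) outer) x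
      to-ty (inj₁ (inj₁ a))   = refl
      to-ty (inj₂ (zero , b)) = refl

    diagram : WD (box A B ∷ []) outer
    diagram = fromForwardConn connection (λ { zero j q p () })

    unitors : BoxIso outer (box A B)
    unitors = record { isoIn = ⊕-unitʳ A ; isoOut = ⊕-unitʳ B }

    unitorSrc : TIso (SrcPorts (box A B ∷ []) outer) (SrcPorts (box A B ∷ []) (box A B))
    unitorSrc = mkTIso to from (λ { (inj₁ _) → refl ; (inj₂ (zero , _)) → refl })
                               (λ { (inj₁ (inj₁ _)) → refl ; (inj₂ (zero , _)) → refl })
                               (λ { (inj₁ (inj₁ _)) → refl ; (inj₂ (zero , _)) → refl })
      where
      to : Carrier (SrcPorts (box A B ∷ []) outer) → Carrier (SrcPorts (box A B ∷ []) (box A B))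
      to (inj₁ (inj₁ a)) = inj₁ a
      to (inj₂ y)        = inj₂ y
      from : Carrier (SrcPorts (box A B ∷ []) (box A B)) → Carrier (SrcPorts (box A B ∷ []) outer)
      from (inj₁ a) = inj₁ (inj₁ a)
      from (inj₂ y) = inj₂ y

    agrees : ConnAgrees (suc zero) (unitWD ∅) (paraWD A ∅ B ∅) diagram
    agrees (inj₁ (inj₁ a))   = refl
    agrees (inj₂ (zero , b)) = refl

    relabels : ConnRelabels id (idBoxes {τ} {box A B ∷ []}) unitors diagram (idWD (box A B)) unitorSrc
    relabels (inj₁ (inj₁ a))   = refl
    relabels (inj₂ (zero , b)) = refl

    diagram≈id : diagram ≈[ unitors ] idWD (box A B)
    diagram≈id = iso-byConn id (idBoxes {τ} {box A B ∷ []}) unitors diagram (idWD (box A B)) unitorSrc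
                   (λ { (inj₁ (inj₁ _)) → refl ; (inj₂ (zero , _)) → refl }) relabels

  paraUnital : ParaUnital {τ}
  paraUnital A B =
      (L.diagram , isComposite-byConn zero (unitWD ∅) (paraWD ∅ A ∅ B) L.diagram L.agrees , L.diagram≈id)
    , (R.diagram , isComposite-byConn (suc zero) (unitWD ∅) (paraWD A ∅ B ∅) R.diagram R.agrees , R.diagram≈id)
    where
    module L = ParaUnitalˡ A B
    module R = ParaUnitalʳ A B

  module ParaAssoc (A A' A'' B B' B'' : TSet {τ}) where
    boxes : List (Box {τ})
    boxes = box A B ∷ box A' B' ∷ box A'' B'' ∷ []

    outerˡ outerʳ : Box {τ}
    outerˡ = box ((A ⊕ₛ A') ⊕ₛ A'') ((B ⊕ₛ B') ⊕ₛ B'')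
    outerʳ = box (A ⊕ₛ (A' ⊕ₛ A'')) (B ⊕ₛ (B' ⊕ₛ B''))

    connectionˡ : TIso (SrcPorts boxes outerˡ) (TgtPorts boxes outerˡ)
    connectionˡ = mkTIso to from to∘from from∘to to-ty
      where
      to : Carrier (SrcPorts boxes outerˡ) → Carrier (TgtPorts boxes outerˡ)
      to (inj₁ (inj₁ (inj₁ a)))      = inj₁ (zero , a)
      to (inj₁ (inj₁ (inj₂ a)))      = inj₁ (suc zero , a)
      to (inj₁ (inj₂ a))             = inj₁ (suc (suc zero) , a)
      to (inj₂ (zero , b))           = inj₂ (inj₁ (inj₁ b))
      to (inj₂ (suc zero , b))       = inj₂ (inj₁ (inj₂ b))
      to (inj₂ (suc (suc zero) , b)) = inj₂ (inj₂ b)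
      from : Carrier (TgtPorts boxes outerˡ) → Carrier (SrcPorts boxes outerˡ)
      from (inj₁ (zero , a))           = inj₁ (inj₁ (inj₁ a))
      from (inj₁ (suc zero , a))       = inj₁ (inj₁ (inj₂ a))
      from (inj₁ (suc (suc zero) , a)) = inj₁ (inj₂ a)
      from (inj₂ (inj₁ (inj₁ b)))      = inj₂ (zero , b)
      from (inj₂ (inj₁ (inj₂ b)))      = inj₂ (suc zero , b)
      from (inj₂ (inj₂ b))             = inj₂ (suc (suc zero) , b)
      to∘from : ∀ y → to (from y) ≡ y
      to∘from (inj₁ (zero , a))           = refl
      to∘from (inj₁ (suc zero , a))       = refl
      to∘from (inj₁ (suc (suc zero) , a)) = refl
      to∘from (inj₂ (inj₁ (inj₁ b)))      = refl
      to∘from (inj₂ (inj₁ (inj₂ b)))      = refl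
      to∘from (inj₂ (inj₂ b))             = refl
      from∘to : ∀ x → from (to x) ≡ x
      from∘to (inj₁ (inj₁ (inj₁ a)))      = refl
      from∘to (inj₁ (inj₁ (inj₂ a)))      = refl
      from∘to (inj₁ (inj₂ a))             = refl
      from∘to (inj₂ (zero , b))           = refl
      from∘to (inj₂ (suc zero , b))       = refl
      from∘to (inj₂ (suc (suc zero) , b)) = refl
      to-ty : ∀ x → ty (TgtPorts boxes outerˡ) (to x) ≡ ty (SrcPorts boxes outerˡ) x
      to-ty (inj₁ (inj₁ (inj₁ a)))      = refl
      to-ty (inj₁ (inj₁ (inj₂ a)))      = refl
      to-ty (inj₁ (inj₂ a))             = refl
      to-ty (inj₂ (zero , b))           = refl
      to-ty (inj₂ (suc zero , b))       = refl
      to-ty (inj₂ (suc (suc zero) , b)) = refl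

    connectionʳ : TIso (SrcPorts boxes outerʳ) (TgtPorts boxes outerʳ)
    connectionʳ = mkTIso to from to∘from from∘to to-ty
      where
      to : Carrier (SrcPorts boxes outerʳ) → Carrier (TgtPorts boxes outerʳ)
      to (inj₁ (inj₁ a))             = inj₁ (zero , a)
      to (inj₁ (inj₂ (inj₁ a)))      = inj₁ (suc zero , a)
      to (inj₁ (inj₂ (inj₂ a)))      = inj₁ (suc (suc zero) , a)
      to (inj₂ (zero , b))           = inj₂ (inj₁ b)
      to (inj₂ (suc zero , b))       = inj₂ (inj₂ (inj₁ b))
      to (inj₂ (suc (suc zero) , b)) = inj₂ (inj₂ (inj₂ b))
      from : Carrier (TgtPorts boxes outerʳ) → Carrier (SrcPorts boxes outerʳ)
      from (inj₁ (zero , a))           = inj₁ (inj₁ a)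
      from (inj₁ (suc zero , a))       = inj₁ (inj₂ (inj₁ a))
      from (inj₁ (suc (suc zero) , a)) = inj₁ (inj₂ (inj₂ a))
      from (inj₂ (inj₁ b))             = inj₂ (zero , b)
      from (inj₂ (inj₂ (inj₁ b)))      = inj₂ (suc zero , b)
      from (inj₂ (inj₂ (inj₂ b)))      = inj₂ (suc (suc zero) , b)
      to∘from : ∀ y → to (from y) ≡ y
      to∘from (inj₁ (zero , a))           = refl
      to∘from (inj₁ (suc zero , a))       = refl
      to∘from (inj₁ (suc (suc zero) , a)) = refl
      to∘from (inj₂ (inj₁ b))             = refl
      to∘from (inj₂ (inj₂ (inj₁ b)))      = refl
      to∘from (inj₂ (inj₂ (inj₂ b)))      = refl
      from∘to : ∀ x → from (to x) ≡ x
      from∘to (inj₁ (inj₁ a))             = refl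
      from∘to (inj₁ (inj₂ (inj₁ a)))      = refl
      from∘to (inj₁ (inj₂ (inj₂ a)))      = refl
      from∘to (inj₂ (zero , b))           = refl
      from∘to (inj₂ (suc zero , b))       = refl
      from∘to (inj₂ (suc (suc zero) , b)) = refl
      to-ty : ∀ x → ty (TgtPorts boxes outerʳ) (to x) ≡ ty (SrcPorts boxes outerʳ) x
      to-ty (inj₁ (inj₁ a))             = refl
      to-ty (inj₁ (inj₂ (inj₁ a)))      = refl
      to-ty (inj₁ (inj₂ (inj₂ a)))      = refl
      to-ty (inj₂ (zero , b))           = refl
      to-ty (inj₂ (suc zero , b))       = refl
      to-ty (inj₂ (suc (suc zero) , b)) = refl

    diagramˡ : WD boxes outerˡ
    diagramˡ = fromForwardConn connectionˡ (λ { zero _ _ _ () ; (suc zero) _ _ _ () ; (suc (suc zero)) _ _ _ () })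

    diagramʳ : WD boxes outerʳ
    diagramʳ = fromForwardConn connectionʳ (λ { zero _ _ _ () ; (suc zero) _ _ _ () ; (suc (suc zero)) _ _ _ () })

    associators : BoxIso outerˡ outerʳ
    associators = record { isoIn = ⊕-assoc A A' A'' ; isoOut = ⊕-assoc B B' B'' }

    associatorSrc : TIso (SrcPorts boxes outerˡ) (SrcPorts boxes outerʳ)
    associatorSrc = mkTIso to from to∘from from∘to to-ty
      where
      to : Carrier (SrcPorts boxes outerˡ) → Carrier (SrcPorts boxes outerʳ)
      to (inj₁ (inj₁ (inj₁ a))) = inj₁ (inj₁ a)
      to (inj₁ (inj₁ (inj₂ a))) = inj₁ (inj₂ (inj₁ a))
      to (inj₁ (inj₂ a))        = inj₁ (inj₂ (inj₂ a))
      to (inj₂ y)               = inj₂ y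
      from : Carrier (SrcPorts boxes outerʳ) → Carrier (SrcPorts boxes outerˡ)
      from (inj₁ (inj₁ a))        = inj₁ (inj₁ (inj₁ a))
      from (inj₁ (inj₂ (inj₁ a))) = inj₁ (inj₁ (inj₂ a))
      from (inj₁ (inj₂ (inj₂ a))) = inj₁ (inj₂ a)
      from (inj₂ y)               = inj₂ y
      to∘from : ∀ y → to (from y) ≡ y
      to∘from (inj₁ (inj₁ a))        = refl
      to∘from (inj₁ (inj₂ (inj₁ a))) = refl
      to∘from (inj₁ (inj₂ (inj₂ a))) = refl
      to∘from (inj₂ y)               = refl
      from∘to : ∀ x → from (to x) ≡ x
      from∘to (inj₁ (inj₁ (inj₁ a))) = refl
      from∘to (inj₁ (inj₁ (inj₂ a))) = refl
      from∘to (inj₁ (inj₂ a))        = refl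
      from∘to (inj₂ y)               = refl
      to-ty : ∀ x → ty (SrcPorts boxes outerʳ) (to x) ≡ ty (SrcPorts boxes outerˡ) x
      to-ty (inj₁ (inj₁ (inj₁ a))) = refl
      to-ty (inj₁ (inj₁ (inj₂ a))) = refl
      to-ty (inj₁ (inj₂ a))        = refl
      to-ty (inj₂ y)               = refl

    agreesˡ : ConnAgrees zero (paraWD A A' B B') (paraWD (A ⊕ₛ A') A'' (B ⊕ₛ B') B'') diagramˡ
    agreesˡ (inj₁ (inj₁ (inj₁ a)))      = refl
    agreesˡ (inj₁ (inj₁ (inj₂ a)))      = refl
    agreesˡ (inj₁ (inj₂ a))             = refl
    agreesˡ (inj₂ (zero , b))           = refl
    agreesˡ (inj₂ (suc zero , b))       = refl
    agreesˡ (inj₂ (suc (suc zero) , b)) = refl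

    agreesʳ : ConnAgrees (suc zero) (paraWD A' A'' B' B'') (paraWD A (A' ⊕ₛ A'') B (B' ⊕ₛ B'')) diagramʳ
    agreesʳ (inj₁ (inj₁ a))             = refl
    agreesʳ (inj₁ (inj₂ (inj₁ a)))      = refl
    agreesʳ (inj₁ (inj₂ (inj₂ a)))      = refl
    agreesʳ (inj₂ (zero , b))           = refl
    agreesʳ (inj₂ (suc zero , b))       = refl
    agreesʳ (inj₂ (suc (suc zero) , b)) = refl

    relabels : ConnRelabels id (idBoxes {τ} {boxes}) associators diagramˡ diagramʳ associatorSrc
    relabels (inj₁ (inj₁ (inj₁ a)))      = refl
    relabels (inj₁ (inj₁ (inj₂ a)))      = refl
    relabels (inj₁ (inj₂ a))             = refl
    relabels (inj₂ (zero , b))           = refl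
    relabels (inj₂ (suc zero , b))       = refl
    relabels (inj₂ (suc (suc zero) , b)) = refl

    diagramˡ≈diagramʳ : diagramˡ ≈[ associators ] diagramʳ
    diagramˡ≈diagramʳ =
      iso-byConn id (idBoxes {τ} {boxes}) associators diagramˡ diagramʳ associatorSrc src-relabels relabels
      where
      src-relabels : app associatorSrc ≗ relabelSrc id (idBoxes {τ} {boxes}) associators
      src-relabels (inj₁ (inj₁ (inj₁ a))) = refl
      src-relabels (inj₁ (inj₁ (inj₂ a))) = refl
      src-relabels (inj₁ (inj₂ a))        = refl
      src-relabels (inj₂ (k , q))         = refl

  paraAssoc : ParaAssoc {τ}
  paraAssoc A A' A'' B B' B'' =
    diagramˡ , diagramʳ
    , isComposite-byConn zero (paraWD A A' B B') (paraWD (A ⊕ₛ A') A'' (B ⊕ₛ B') B'') diagramˡ agreesˡ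
    , isComposite-byConn (suc zero) (paraWD A' A'' B' B'') (paraWD A (A' ⊕ₛ A'') B (B' ⊕ₛ B'')) diagramʳ agreesʳ
    , diagramˡ≈diagramʳ
    where open ParaAssoc A A' A'' B B' B''

  module Interchange (A A' B B' C C' : TSet {τ}) where
    outer : Box {τ}
    outer = box (A ⊕ₛ A') (C ⊕ₛ C')

    boxes₁ boxesˡ boxes₂ boxesʳ : List (Box {τ})
    boxes₁ = box A C ∷ box A' B' ∷ box B' C' ∷ []
    boxesˡ = box A B ∷ box B C ∷ box A' B' ∷ box B' C' ∷ []
    boxes₂ = box (A ⊕ₛ A') (B ⊕ₛ B') ∷ box B C ∷ box B' C' ∷ []
    boxesʳ = box A B ∷ box A' B' ∷ box B C ∷ box B' C' ∷ []

    connection₁ : TIso (SrcPorts boxes₁ outer) (TgtPorts boxes₁ outer)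
    connection₁ = mkTIso to from to∘from from∘to to-ty
      where
      to : Carrier (SrcPorts boxes₁ outer) → Carrier (TgtPorts boxes₁ outer)
      to (inj₁ (inj₁ a))             = inj₁ (zero , a)
      to (inj₁ (inj₂ a))             = inj₁ (suc zero , a)
      to (inj₂ (zero , c))           = inj₂ (inj₁ c)
      to (inj₂ (suc zero , b))       = inj₁ (suc (suc zero) , b)
      to (inj₂ (suc (suc zero) , c)) = inj₂ (inj₂ c)
      from : Carrier (TgtPorts boxes₁ outer) → Carrier (SrcPorts boxes₁ outer)
      from (inj₁ (zero , a))           = inj₁ (inj₁ a)
      from (inj₁ (suc zero , a))       = inj₁ (inj₂ a)
      from (inj₁ (suc (suc zero) , b)) = inj₂ (suc zero , b)
      from (inj₂ (inj₁ c))             = inj₂ (zero , c)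
      from (inj₂ (inj₂ c))             = inj₂ (suc (suc zero) , c)
      to∘from : ∀ y → to (from y) ≡ y
      to∘from (inj₁ (zero , a))           = refl
      to∘from (inj₁ (suc zero , a))       = refl
      to∘from (inj₁ (suc (suc zero) , b)) = refl
      to∘from (inj₂ (inj₁ c))             = refl
      to∘from (inj₂ (inj₂ c))             = refl
      from∘to : ∀ x → from (to x) ≡ x
      from∘to (inj₁ (inj₁ a))             = refl
      from∘to (inj₁ (inj₂ a))             = refl
      from∘to (inj₂ (zero , c))           = refl
      from∘to (inj₂ (suc zero , b))       = refl
      from∘to (inj₂ (suc (suc zero) , c)) = refl
      to-ty : ∀ x → ty (TgtPorts boxes₁ outer) (to x) ≡ ty (SrcPorts boxes₁ outer) x
      to-ty (inj₁ (inj₁ a))             = refl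
      to-ty (inj₁ (inj₂ a))             = refl
      to-ty (inj₂ (zero , c))           = refl
      to-ty (inj₂ (suc zero , b))       = refl
      to-ty (inj₂ (suc (suc zero) , c)) = refl

    forward₁ : Forward {boxes₁} {outer} connection₁
    forward₁ zero             j q p ()
    forward₁ (suc zero)       .(suc (suc zero)) q .q refl = s≤s (s≤s z≤n)
    forward₁ (suc (suc zero)) j q p ()

    connectionˡ : TIso (SrcPorts boxesˡ outer) (TgtPorts boxesˡ outer)
    connectionˡ = mkTIso to from to∘from from∘to to-ty
      where
      to : Carrier (SrcPorts boxesˡ outer) → Carrier (TgtPorts boxesˡ outer)
      to (inj₁ (inj₁ a))                   = inj₁ (zero , a)
      to (inj₁ (inj₂ a))                   = inj₁ (suc (suc zero) , a)
      to (inj₂ (zero , b))                 = inj₁ (suc zero , b)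
      to (inj₂ (suc zero , c))             = inj₂ (inj₁ c)
      to (inj₂ (suc (suc zero) , b))       = inj₁ (suc (suc (suc zero)) , b)
      to (inj₂ (suc (suc (suc zero)) , c)) = inj₂ (inj₂ c)
      from : Carrier (TgtPorts boxesˡ outer) → Carrier (SrcPorts boxesˡ outer)
      from (inj₁ (zero , a))                 = inj₁ (inj₁ a)
      from (inj₁ (suc zero , b))             = inj₂ (zero , b)
      from (inj₁ (suc (suc zero) , a))       = inj₁ (inj₂ a)
      from (inj₁ (suc (suc (suc zero)) , b)) = inj₂ (suc (suc zero) , b)
      from (inj₂ (inj₁ c))                   = inj₂ (suc zero , c)
      from (inj₂ (inj₂ c))                   = inj₂ (suc (suc (suc zero)) , c)
      to∘from : ∀ y → to (from y) ≡ y
      to∘from (inj₁ (zero , a))                 = refl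
      to∘from (inj₁ (suc zero , b))             = refl
      to∘from (inj₁ (suc (suc zero) , a))       = refl
      to∘from (inj₁ (suc (suc (suc zero)) , b)) = refl
      to∘from (inj₂ (inj₁ c))                   = refl
      to∘from (inj₂ (inj₂ c))                   = refl
      from∘to : ∀ x → from (to x) ≡ x
      from∘to (inj₁ (inj₁ a))                   = refl
      from∘to (inj₁ (inj₂ a))                   = refl
      from∘to (inj₂ (zero , b))                 = refl
      from∘to (inj₂ (suc zero , c))             = refl
      from∘to (inj₂ (suc (suc zero) , b))       = refl
      from∘to (inj₂ (suc (suc (suc zero)) , c)) = refl
      to-ty : ∀ x → ty (TgtPorts boxesˡ outer) (to x) ≡ ty (SrcPorts boxesˡ outer) x
      to-ty (inj₁ (inj₁ a))                   = refl
      to-ty (inj₁ (inj₂ a))                   = refl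
      to-ty (inj₂ (zero , b))                 = refl
      to-ty (inj₂ (suc zero , c))             = refl
      to-ty (inj₂ (suc (suc zero) , b))       = refl
      to-ty (inj₂ (suc (suc (suc zero)) , c)) = refl

    forwardˡ : Forward {boxesˡ} {outer} connectionˡ
    forwardˡ zero                   .(suc zero)             q .q refl = s≤s z≤n
    forwardˡ (suc zero)             j q p ()
    forwardˡ (suc (suc zero))       .(suc (suc (suc zero))) q .q refl = s≤s (s≤s (s≤s z≤n))
    forwardˡ (suc (suc (suc zero))) j q p ()

    connection₂ : TIso (SrcPorts boxes₂ outer) (TgtPorts boxes₂ outer)
    connection₂ = mkTIso to from to∘from from∘to to-ty
      where
      to : Carrier (SrcPorts boxes₂ outer) → Carrier (TgtPorts boxes₂ outer)
      to (inj₁ x)                    = inj₁ (zero , x)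
      to (inj₂ (zero , inj₁ b))      = inj₁ (suc zero , b)
      to (inj₂ (zero , inj₂ b))      = inj₁ (suc (suc zero) , b)
      to (inj₂ (suc zero , c))       = inj₂ (inj₁ c)
      to (inj₂ (suc (suc zero) , c)) = inj₂ (inj₂ c)
      from : Carrier (TgtPorts boxes₂ outer) → Carrier (SrcPorts boxes₂ outer)
      from (inj₁ (zero , x))           = inj₁ x
      from (inj₁ (suc zero , b))       = inj₂ (zero , inj₁ b)
      from (inj₁ (suc (suc zero) , b)) = inj₂ (zero , inj₂ b)
      from (inj₂ (inj₁ c))             = inj₂ (suc zero , c)
      from (inj₂ (inj₂ c))             = inj₂ (suc (suc zero) , c)
      to∘from : ∀ y → to (from y) ≡ y
      to∘from (inj₁ (zero , x))           = refl
      to∘from (inj₁ (suc zero , b))       = refl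
      to∘from (inj₁ (suc (suc zero) , b)) = refl
      to∘from (inj₂ (inj₁ c))             = refl
      to∘from (inj₂ (inj₂ c))             = refl
      from∘to : ∀ x → from (to x) ≡ x
      from∘to (inj₁ x)                    = refl
      from∘to (inj₂ (zero , inj₁ b))      = refl
      from∘to (inj₂ (zero , inj₂ b))      = refl
      from∘to (inj₂ (suc zero , c))       = refl
      from∘to (inj₂ (suc (suc zero) , c)) = refl
      to-ty : ∀ x → ty (TgtPorts boxes₂ outer) (to x) ≡ ty (SrcPorts boxes₂ outer) x
      to-ty (inj₁ x)                    = refl
      to-ty (inj₂ (zero , inj₁ b))      = refl
      to-ty (inj₂ (zero , inj₂ b))      = refl
      to-ty (inj₂ (suc zero , c))       = refl
      to-ty (inj₂ (suc (suc zero) , c)) = refl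

    forward₂ : Forward {boxes₂} {outer} connection₂
    forward₂ zero             .(suc zero)       (inj₁ b) .b refl = s≤s z≤n
    forward₂ zero             .(suc (suc zero)) (inj₂ b) .b refl = s≤s z≤n
    forward₂ (suc zero)       j q p ()
    forward₂ (suc (suc zero)) j q p ()

    connectionʳ : TIso (SrcPorts boxesʳ outer) (TgtPorts boxesʳ outer)
    connectionʳ = mkTIso to from to∘from from∘to to-ty
      where
      to : Carrier (SrcPorts boxesʳ outer) → Carrier (TgtPorts boxesʳ outer)
      to (inj₁ (inj₁ a))                   = inj₁ (zero , a)
      to (inj₁ (inj₂ a))                   = inj₁ (suc zero , a)
      to (inj₂ (zero , b))                 = inj₁ (suc (suc zero) , b)
      to (inj₂ (suc zero , b))             = inj₁ (suc (suc (suc zero)) , b)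
      to (inj₂ (suc (suc zero) , c))       = inj₂ (inj₁ c)
      to (inj₂ (suc (suc (suc zero)) , c)) = inj₂ (inj₂ c)
      from : Carrier (TgtPorts boxesʳ outer) → Carrier (SrcPorts boxesʳ outer)
      from (inj₁ (zero , a))                 = inj₁ (inj₁ a)
      from (inj₁ (suc zero , a))             = inj₁ (inj₂ a)
      from (inj₁ (suc (suc zero) , b))       = inj₂ (zero , b)
      from (inj₁ (suc (suc (suc zero)) , b)) = inj₂ (suc zero , b)
      from (inj₂ (inj₁ c))                   = inj₂ (suc (suc zero) , c)
      from (inj₂ (inj₂ c))                   = inj₂ (suc (suc (suc zero)) , c)
      to∘from : ∀ y → to (from y) ≡ y
      to∘from (inj₁ (zero , a))                 = refl
      to∘from (inj₁ (suc zero , a))             = refl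
      to∘from (inj₁ (suc (suc zero) , b))       = refl
      to∘from (inj₁ (suc (suc (suc zero)) , b)) = refl
      to∘from (inj₂ (inj₁ c))                   = refl
      to∘from (inj₂ (inj₂ c))                   = refl
      from∘to : ∀ x → from (to x) ≡ x
      from∘to (inj₁ (inj₁ a))                   = refl
      from∘to (inj₁ (inj₂ a))                   = refl
      from∘to (inj₂ (zero , b))                 = refl
      from∘to (inj₂ (suc zero , b))             = refl
      from∘to (inj₂ (suc (suc zero) , c))       = refl
      from∘to (inj₂ (suc (suc (suc zero)) , c)) = refl
      to-ty : ∀ x → ty (TgtPorts boxesʳ outer) (to x) ≡ ty (SrcPorts boxesʳ outer) x
      to-ty (inj₁ (inj₁ a))                   = refl
      to-ty (inj₁ (inj₂ a))                   = refl
      to-ty (inj₂ (zero , b))                 = refl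
      to-ty (inj₂ (suc zero , b))             = refl
      to-ty (inj₂ (suc (suc zero) , c))       = refl
      to-ty (inj₂ (suc (suc (suc zero)) , c)) = refl

    forwardʳ : Forward {boxesʳ} {outer} connectionʳ
    forwardʳ zero                   .(suc (suc zero))       q .q refl = s≤s z≤n
    forwardʳ (suc zero)             .(suc (suc (suc zero))) q .q refl = s≤s (s≤s z≤n)
    forwardʳ (suc (suc zero))       j q p ()
    forwardʳ (suc (suc (suc zero))) j q p ()

    diagram₁ : WD boxes₁ outer
    diagram₁ = fromForwardConn connection₁ forward₁

    diagramˡ : WD boxesˡ outer
    diagramˡ = fromForwardConn connectionˡ forwardˡ

    diagram₂ : WD boxes₂ outer
    diagram₂ = fromForwardConn connection₂ forward₂

    diagramʳ : WD boxesʳ outer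
    diagramʳ = fromForwardConn connectionʳ forwardʳ

    swapSrc : TIso (SrcPorts boxesˡ outer) (SrcPorts boxesʳ outer)
    swapSrc = mkTIso to from to∘from from∘to to-ty
      where
      to : Carrier (SrcPorts boxesˡ outer) → Carrier (SrcPorts boxesʳ outer)
      to (inj₁ x)                          = inj₁ x
      to (inj₂ (zero , b))                 = inj₂ (zero , b)
      to (inj₂ (suc zero , c))             = inj₂ (suc (suc zero) , c)
      to (inj₂ (suc (suc zero) , b))       = inj₂ (suc zero , b)
      to (inj₂ (suc (suc (suc zero)) , c)) = inj₂ (suc (suc (suc zero)) , c)
      from : Carrier (SrcPorts boxesʳ outer) → Carrier (SrcPorts boxesˡ outer)
      from (inj₁ x)                          = inj₁ x
      from (inj₂ (zero , b))                 = inj₂ (zero , b)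
      from (inj₂ (suc zero , b))             = inj₂ (suc (suc zero) , b)
      from (inj₂ (suc (suc zero) , c))       = inj₂ (suc zero , c)
      from (inj₂ (suc (suc (suc zero)) , c)) = inj₂ (suc (suc (suc zero)) , c)
      to∘from : ∀ y → to (from y) ≡ y
      to∘from (inj₁ x)                          = refl
      to∘from (inj₂ (zero , b))                 = refl
      to∘from (inj₂ (suc zero , b))             = refl
      to∘from (inj₂ (suc (suc zero) , c))       = refl
      to∘from (inj₂ (suc (suc (suc zero)) , c)) = refl
      from∘to : ∀ x → from (to x) ≡ x
      from∘to (inj₁ x)                          = refl
      from∘to (inj₂ (zero , b))                 = refl
      from∘to (inj₂ (suc zero , c))             = refl
      from∘to (inj₂ (suc (suc zero) , b))       = refl
      from∘to (inj₂ (suc (suc (suc zero)) , c)) = refl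
      to-ty : ∀ x → ty (SrcPorts boxesʳ outer) (to x) ≡ ty (SrcPorts boxesˡ outer) x
      to-ty (inj₁ x)                          = refl
      to-ty (inj₂ (zero , b))                 = refl
      to-ty (inj₂ (suc zero , c))             = refl
      to-ty (inj₂ (suc (suc zero) , b))       = refl
      to-ty (inj₂ (suc (suc (suc zero)) , c)) = refl

    agrees₁ : ConnAgrees (suc zero) (seqWD A' B' C') (paraWD A A' C C') diagram₁
    agrees₁ (inj₁ (inj₁ a))             = refl
    agrees₁ (inj₁ (inj₂ a))             = refl
    agrees₁ (inj₂ (zero , c))           = refl
    agrees₁ (inj₂ (suc zero , b))       = refl
    agrees₁ (inj₂ (suc (suc zero) , c)) = refl

    agreesˡ : ConnAgrees zero (seqWD A B C) diagram₁ diagramˡ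
    agreesˡ (inj₁ (inj₁ a))                   = refl
    agreesˡ (inj₁ (inj₂ a))                   = refl
    agreesˡ (inj₂ (zero , b))                 = refl
    agreesˡ (inj₂ (suc zero , c))             = refl
    agreesˡ (inj₂ (suc (suc zero) , b))       = refl
    agreesˡ (inj₂ (suc (suc (suc zero)) , c)) = refl

    agrees₂ : ConnAgrees (suc zero) (paraWD B B' C C') (seqWD (A ⊕ₛ A') (B ⊕ₛ B') (C ⊕ₛ C')) diagram₂
    agrees₂ (inj₁ x)                    = refl
    agrees₂ (inj₂ (zero , inj₁ b))      = refl
    agrees₂ (inj₂ (zero , inj₂ b))      = refl
    agrees₂ (inj₂ (suc zero , c))       = refl
    agrees₂ (inj₂ (suc (suc zero) , c)) = refl

    agreesʳ : ConnAgrees zero (paraWD A A' B B') diagram₂ diagramʳ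
    agreesʳ (inj₁ (inj₁ a))                   = refl
    agreesʳ (inj₁ (inj₂ a))                   = refl
    agreesʳ (inj₂ (zero , b))                 = refl
    agreesʳ (inj₂ (suc zero , b))             = refl
    agreesʳ (inj₂ (suc (suc zero) , c))       = refl
    agreesʳ (inj₂ (suc (suc (suc zero)) , c)) = refl

    middleSwap : ∀ k → BoxIso (lookup boxesˡ k) (lookup boxesʳ (swap12 {τ} k))
    middleSwap = idBoxes12 (box A B) (box B C) (box A' B') (box B' C')

    relabels : ConnRelabels (swap12 {τ}) middleSwap idBox diagramˡ diagramʳ swapSrc
    relabels (inj₁ (inj₁ a))                   = refl
    relabels (inj₁ (inj₂ a))                   = refl
    relabels (inj₂ (zero , b))                 = refl
    relabels (inj₂ (suc zero , c))             = refl
    relabels (inj₂ (suc (suc zero) , b))       = refl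
    relabels (inj₂ (suc (suc (suc zero)) , c)) = refl

    diagramˡ≅diagramʳ : Iso[ swap12 {τ} , middleSwap , idBox ] diagramˡ diagramʳ
    diagramˡ≅diagramʳ = iso-byConn (swap12 {τ}) middleSwap idBox diagramˡ diagramʳ swapSrc src-relabels relabels
      where
      src-relabels : app swapSrc ≗ relabelSrc (swap12 {τ}) middleSwap idBox
      src-relabels (inj₁ x)                          = refl
      src-relabels (inj₂ (zero , b))                 = refl
      src-relabels (inj₂ (suc zero , c))             = refl
      src-relabels (inj₂ (suc (suc zero) , b))       = refl
      src-relabels (inj₂ (suc (suc (suc zero)) , c)) = refl

  interchange : Interchange {τ}
  interchange A A' B B' C C' =
    diagram₁ , diagramˡ , diagram₂ , diagramʳ
    , isComposite-byConn (suc zero) (seqWD A' B' C') (paraWD A A' C C') diagram₁ agrees₁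
    , isComposite-byConn zero (seqWD A B C) diagram₁ diagramˡ agreesˡ
    , isComposite-byConn (suc zero) (paraWD B B' C C') (seqWD (A ⊕ₛ A') (B ⊕ₛ B') (C ⊕ₛ C')) diagram₂ agrees₂
    , isComposite-byConn zero (paraWD A A' B B') diagram₂ diagramʳ agreesʳ
    , diagramˡ≅diagramʳ
    where open Interchange A A' B B' C C'

  module PermSeq (ω : TSet {τ}) (ρ : TIso ⌊ ω ⌋ ⌊ ω ⌋) where
    connection : TIso (SrcPorts (box ω ω ∷ []) (box ω ω)) (TgtPorts (box ω ω ∷ []) (box ω ω))
    connection = mkTIso to from to∘from from∘to to-ty
      where
      to : Carrier (SrcPorts (box ω ω ∷ []) (box ω ω)) → Carrier (TgtPorts (box ω ω ∷ []) (box ω ω))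
      to (inj₁ x)          = inj₁ (zero , x)
      to (inj₂ (zero , y)) = inj₂ (app ρ y)
      from : Carrier (TgtPorts (box ω ω ∷ []) (box ω ω)) → Carrier (SrcPorts (box ω ω ∷ []) (box ω ω))
      from (inj₁ (zero , x)) = inj₁ x
      from (inj₂ z)          = inj₂ (zero , app⁻ ρ z)
      to∘from : ∀ y → to (from y) ≡ y
      to∘from (inj₁ (zero , x)) = refl
      to∘from (inj₂ z)          = cong inj₂ (app∘app⁻ ρ z)
      from∘to : ∀ x → from (to x) ≡ x
      from∘to (inj₁ x)          = refl
      from∘to (inj₂ (zero , y)) = cong (λ u → inj₂ (zero , u)) (app⁻∘app ρ y)
      to-ty : ∀ x → ty (TgtPorts (box ω ω ∷ []) (box ω ω)) (to x) ≡ ty (SrcPorts (box ω ω ∷ []) (box ω ω)) x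
      to-ty (inj₁ x)          = refl
      to-ty (inj₂ (zero , y)) = pres ρ y

    diagram : WD (box ω ω ∷ []) (box ω ω)
    diagram = fromForwardConn connection (λ { zero j q p () })

    agrees : ConnAgrees (suc zero) (symWD ω ρ) (seqWD ω ω ω) diagram
    agrees (inj₁ x)          = refl
    agrees (inj₂ (zero , y)) = refl

  permSeq : PermSeq {τ}
  permSeq ω σ ρ = diagram , symWD ω (ρ ∘ᵗ σ)
    , isComposite-byConn (suc zero) (symWD ω ρ) (seqWD ω ω ω) diagram agrees
    , isComposite-byConn zero (symWD ω σ) diagram (symWD ω (ρ ∘ᵗ σ)) (λ { (inj₁ x) → refl })
    , ≈-refl (symWD ω (ρ ∘ᵗ σ))
    where open PermSeq ω ρ

  module PermPara (ω ω' : TSet {τ}) (ρ : TIso ⌊ ω' ⌋ ⌊ ω' ⌋) where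
    outer : Box {τ}
    outer = box (ω ⊕ₛ ω') (ω ⊕ₛ ω')

    connection : TIso (SrcPorts (box ω ω ∷ []) outer) (TgtPorts (box ω ω ∷ []) outer)
    connection = mkTIso to from to∘from from∘to to-ty
      where
      to : Carrier (SrcPorts (box ω ω ∷ []) outer) → Carrier (TgtPorts (box ω ω ∷ []) outer)
      to (inj₁ (inj₁ x))   = inj₁ (zero , x)
      to (inj₁ (inj₂ x))   = inj₂ (inj₂ (app ρ x))
      to (inj₂ (zero , y)) = inj₂ (inj₁ y)
      from : Carrier (TgtPorts (box ω ω ∷ []) outer) → Carrier (SrcPorts (box ω ω ∷ []) outer)
      from (inj₁ (zero , x)) = inj₁ (inj₁ x)
      from (inj₂ (inj₁ y))   = inj₂ (zero , y)
      from (inj₂ (inj₂ z))   = inj₁ (inj₂ (app⁻ ρ z))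
      to∘from : ∀ y → to (from y) ≡ y
      to∘from (inj₁ (zero , x)) = refl
      to∘from (inj₂ (inj₁ y))   = refl
      to∘from (inj₂ (inj₂ z))   = cong (inj₂ ∘ inj₂) (app∘app⁻ ρ z)
      from∘to : ∀ x → from (to x) ≡ x
      from∘to (inj₁ (inj₁ x))   = refl
      from∘to (inj₁ (inj₂ x))   = cong (inj₁ ∘ inj₂) (app⁻∘app ρ x)
      from∘to (inj₂ (zero , y)) = refl
      to-ty : ∀ x → ty (TgtPorts (box ω ω ∷ []) outer) (to x) ≡ ty (SrcPorts (box ω ω ∷ []) outer) x
      to-ty (inj₁ (inj₁ x))   = refl
      to-ty (inj₁ (inj₂ x))   = pres ρ x
      to-ty (inj₂ (zero , y)) = refl

    diagram : WD (box ω ω ∷ []) outer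
    diagram = fromForwardConn connection (λ { zero j q p () })

    agrees : ConnAgrees (suc zero) (symWD ω' ρ) (paraWD ω ω' ω ω') diagram
    agrees (inj₁ (inj₁ x))   = refl
    agrees (inj₁ (inj₂ x))   = refl
    agrees (inj₂ (zero , y)) = refl

  permPara : PermPara {τ}
  permPara ω ω' σ ρ = diagram , symWD (ω ⊕ₛ ω') (σ ⊕ᵗ ρ)
    , isComposite-byConn (suc zero) (symWD ω' ρ) (paraWD ω ω' ω ω') diagram agrees
    , isComposite-byConn zero (symWD ω σ) diagram (symWD (ω ⊕ₛ ω') (σ ⊕ᵗ ρ))
        (λ { (inj₁ (inj₁ x)) → refl ; (inj₁ (inj₂ x)) → refl })
    , ≈-refl (symWD (ω ⊕ₛ ω') (σ ⊕ᵗ ρ))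
    where open PermPara ω ω' ρ

  module PermSwap (A A' B B' : TSet {τ}) where
    boxes boxes' : List (Box {τ})
    boxes  = box A B ∷ box A' B' ∷ []
    boxes' = box A' B' ∷ box A B ∷ []

    outer outer' : Box {τ}
    outer  = box (A ⊕ₛ A') (B ⊕ₛ B')
    outer' = box (A' ⊕ₛ A) (B' ⊕ₛ B)

    swaps : BoxIso outer outer'
    swaps = record { isoIn = ⊕-comm A A' ; isoOut = ⊕-comm B B' }

    swapSrc : TIso (SrcPorts boxes outer) (SrcPorts boxes' outer')
    swapSrc = mkTIso to from to∘from from∘to to-ty
      where
      to : Carrier (SrcPorts boxes outer) → Carrier (SrcPorts boxes' outer')
      to (inj₁ (inj₁ a))       = inj₁ (inj₂ a)
      to (inj₁ (inj₂ a))       = inj₁ (inj₁ a)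
      to (inj₂ (zero , q))     = inj₂ (suc zero , q)
      to (inj₂ (suc zero , q)) = inj₂ (zero , q)
      from : Carrier (SrcPorts boxes' outer') → Carrier (SrcPorts boxes outer)
      from (inj₁ (inj₁ a))       = inj₁ (inj₂ a)
      from (inj₁ (inj₂ a))       = inj₁ (inj₁ a)
      from (inj₂ (zero , q))     = inj₂ (suc zero , q)
      from (inj₂ (suc zero , q)) = inj₂ (zero , q)
      to∘from : ∀ y → to (from y) ≡ y
      to∘from (inj₁ (inj₁ a))       = refl
      to∘from (inj₁ (inj₂ a))       = refl
      to∘from (inj₂ (zero , q))     = refl
      to∘from (inj₂ (suc zero , q)) = refl
      from∘to : ∀ x → from (to x) ≡ x
      from∘to (inj₁ (inj₁ a))       = refl
      from∘to (inj₁ (inj₂ a))       = refl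
      from∘to (inj₂ (zero , q))     = refl
      from∘to (inj₂ (suc zero , q)) = refl
      to-ty : ∀ x → ty (SrcPorts boxes' outer') (to x) ≡ ty (SrcPorts boxes outer) x
      to-ty (inj₁ (inj₁ a))       = refl
      to-ty (inj₁ (inj₂ a))       = refl
      to-ty (inj₂ (zero , q))     = refl
      to-ty (inj₂ (suc zero , q)) = refl

    relabels : ConnRelabels (swap01 {τ}) (idBoxes01 (box A B) (box A' B')) swaps
                 (paraWD A A' B B') (paraWD A' A B' B) swapSrc
    relabels (inj₁ (inj₁ a))       = refl
    relabels (inj₁ (inj₂ a))       = refl
    relabels (inj₂ (zero , q))     = refl
    relabels (inj₂ (suc zero , q)) = refl

    src-relabels : app swapSrc ≗ relabelSrc (swap01 {τ}) (idBoxes01 (box A B) (box A' B')) swaps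
    src-relabels (inj₁ (inj₁ a))       = refl
    src-relabels (inj₁ (inj₂ a))       = refl
    src-relabels (inj₂ (zero , q))     = refl
    src-relabels (inj₂ (suc zero , q)) = refl

  permSwap : PermSwap {τ}
  permSwap A A' B B' = iso-byConn (swap01 {τ}) (idBoxes01 (box A B) (box A' B')) swaps
                         (paraWD A A' B B') (paraWD A' A B' B) swapSrc src-relabels relabels
    where open PermSwap A A' B B'

  _∘ᴮ_ : ∀ {s t u : Box {τ}} → BoxIso t u → BoxIso s t → BoxIso s u
  g ∘ᴮ f = record { isoIn = isoIn g ∘ᵗ isoIn f ; isoOut = isoOut g ∘ᵗ isoOut f }

  record Reindexing (ts ts' : List (Box {τ})) : Set where
    field
      σ      : Fin (length ts) → Fin (length ts')
      σ⁻     : Fin (length ts') → Fin (length ts)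
      σ⁻∘σ   : ∀ k → σ⁻ (σ k) ≡ k
      σ∘σ⁻   : ∀ k → σ (σ⁻ k) ≡ k
      βs     : ∀ k → BoxIso (lookup ts k) (lookup ts' (σ k))
      βs⁻    : ∀ k → BoxIso (lookup ts' k) (lookup ts (σ⁻ k))
      inPort-from∘to  : ∀ k x → _≡_ {A = P In ts}
                          (σ⁻ (σ k) , app (isoIn (βs⁻ (σ k))) (app (isoIn (βs k)) x)) (k , x)
      inPort-to∘from  : ∀ k x → _≡_ {A = P In ts'}
                          (σ (σ⁻ k) , app (isoIn (βs (σ⁻ k))) (app (isoIn (βs⁻ k)) x)) (k , x)
      outPort-from∘to : ∀ k x → _≡_ {A = P Out ts}
                          (σ⁻ (σ k) , app (isoOut (βs⁻ (σ k))) (app (isoOut (βs k)) x)) (k , x)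
      outPort-to∘from : ∀ k x → _≡_ {A = P Out ts'}
                          (σ (σ⁻ k) , app (isoOut (βs (σ⁻ k))) (app (isoOut (βs⁻ k)) x)) (k , x)
  open Reindexing

  reindex-[] : Reindexing [] []
  reindex-[] = record
    { σ = λ () ; σ⁻ = λ () ; σ⁻∘σ = λ () ; σ∘σ⁻ = λ () ; βs = λ () ; βs⁻ = λ ()
    ; inPort-from∘to = λ () ; inPort-to∘from = λ () ; outPort-from∘to = λ () ; outPort-to∘from = λ () }

  reindex-∷ : ∀ t {ts ts'} → Reindexing ts ts' → Reindexing (t ∷ ts) (t ∷ ts')
  reindex-∷ t {ts} {ts'} R = record
    { σ = σ' ; σ⁻ = σ⁻' ; σ⁻∘σ = σ⁻∘σ' ; σ∘σ⁻ = σ∘σ⁻' ; βs = βs' ; βs⁻ = βs⁻'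
    ; inPort-from∘to  = λ { zero x → refl ; (suc k) x → cong (sucᴾ In) (inPort-from∘to R k x) }
    ; inPort-to∘from  = λ { zero x → refl ; (suc k) x → cong (sucᴾ In) (inPort-to∘from R k x) }
    ; outPort-from∘to = λ { zero x → refl ; (suc k) x → cong (sucᴾ Out) (outPort-from∘to R k x) }
    ; outPort-to∘from = λ { zero x → refl ; (suc k) x → cong (sucᴾ Out) (outPort-to∘from R k x) } }
    where
    σ' : Fin (suc (length ts)) → Fin (suc (length ts'))
    σ' zero    = zero
    σ' (suc k) = suc (σ R k)
    σ⁻' : Fin (suc (length ts')) → Fin (suc (length ts))
    σ⁻' zero    = zero
    σ⁻' (suc k) = suc (σ⁻ R k)
    σ⁻∘σ' : ∀ k → σ⁻' (σ' k) ≡ k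
    σ⁻∘σ' zero    = refl
    σ⁻∘σ' (suc k) = cong suc (σ⁻∘σ R k)
    σ∘σ⁻' : ∀ k → σ' (σ⁻' k) ≡ k
    σ∘σ⁻' zero    = refl
    σ∘σ⁻' (suc k) = cong suc (σ∘σ⁻ R k)
    βs' : ∀ k → BoxIso (lookup (t ∷ ts) k) (lookup (t ∷ ts') (σ' k))
    βs' zero    = idBox
    βs' (suc k) = βs R k
    βs⁻' : ∀ k → BoxIso (lookup (t ∷ ts') k) (lookup (t ∷ ts) (σ⁻' k))
    βs⁻' zero    = idBox
    βs⁻' (suc k) = βs⁻ R k

  reindex-refl : ∀ ts → Reindexing ts ts
  reindex-refl []       = reindex-[]
  reindex-refl (t ∷ ts) = reindex-∷ t (reindex-refl ts)

  reindex-++[] : ∀ ts → Reindexing ts (ts ++ [])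
  reindex-++[] []       = reindex-[]
  reindex-++[] (t ∷ ts) = reindex-∷ t (reindex-++[] ts)

  reindex-swap : ∀ a b ts → Reindexing (a ∷ b ∷ ts) (b ∷ a ∷ ts)
  reindex-swap a b ts = record
    { σ = swap ; σ⁻ = swap ; σ⁻∘σ = swap-involutive ; σ∘σ⁻ = swap-involutive ; βs = ids ; βs⁻ = ids'
    ; inPort-from∘to  = λ { zero x → refl ; (suc zero) x → refl ; (suc (suc k)) x → refl }
    ; inPort-to∘from  = λ { zero x → refl ; (suc zero) x → refl ; (suc (suc k)) x → refl }
    ; outPort-from∘to = λ { zero x → refl ; (suc zero) x → refl ; (suc (suc k)) x → refl }
    ; outPort-to∘from = λ { zero x → refl ; (suc zero) x → refl ; (suc (suc k)) x → refl } }
    where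
    swap : Fin (suc (suc (length ts))) → Fin (suc (suc (length ts)))
    swap zero          = suc zero
    swap (suc zero)    = zero
    swap (suc (suc k)) = suc (suc k)
    swap-involutive : ∀ k → swap (swap k) ≡ k
    swap-involutive zero          = refl
    swap-involutive (suc zero)    = refl
    swap-involutive (suc (suc k)) = refl
    ids : ∀ k → BoxIso (lookup (a ∷ b ∷ ts) k) (lookup (b ∷ a ∷ ts) (swap k))
    ids zero          = idBox
    ids (suc zero)    = idBox
    ids (suc (suc k)) = idBox
    ids' : ∀ k → BoxIso (lookup (b ∷ a ∷ ts) k) (lookup (a ∷ b ∷ ts) (swap k))
    ids' zero          = idBox
    ids' (suc zero)    = idBox
    ids' (suc (suc k)) = idBox

  reindex-trans : ∀ {ts ts' ts''} → Reindexing ts ts' → Reindexing ts' ts'' → Reindexing ts ts''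
  reindex-trans {ts} {ts'} {ts''} R S = record
    { σ = λ k → σ S (σ R k)
    ; σ⁻ = λ k → σ⁻ R (σ⁻ S k)
    ; σ⁻∘σ = λ k → trans (cong (σ⁻ R) (σ⁻∘σ S (σ R k))) (σ⁻∘σ R k)
    ; σ∘σ⁻ = λ k → trans (cong (σ S) (σ∘σ⁻ R (σ⁻ S k))) (σ∘σ⁻ S k)
    ; βs = λ k → βs S (σ R k) ∘ᴮ βs R k
    ; βs⁻ = λ k → βs⁻ R (σ⁻ S k) ∘ᴮ βs⁻ S k
    ; inPort-from∘to  = λ k x → trans (cong backIn (inPort-from∘to S (σ R k) (app (isoIn (βs R k)) x)))
                                      (inPort-from∘to R k x)
    ; inPort-to∘from  = λ k x → trans (cong forthIn (inPort-to∘from R (σ⁻ S k) (app (isoIn (βs⁻ S k)) x)))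
                                      (inPort-to∘from S k x)
    ; outPort-from∘to = λ k x → trans (cong backOut (outPort-from∘to S (σ R k) (app (isoOut (βs R k)) x)))
                                      (outPort-from∘to R k x)
    ; outPort-to∘from = λ k x → trans (cong forthOut (outPort-to∘from R (σ⁻ S k) (app (isoOut (βs⁻ S k)) x)))
                                      (outPort-to∘from S k x) }
    where
    backIn : P In ts' → P In ts
    backIn (k , x) = σ⁻ R k , app (isoIn (βs⁻ R k)) x
    backOut : P Out ts' → P Out ts
    backOut (k , x) = σ⁻ R k , app (isoOut (βs⁻ R k)) x
    forthIn : P In ts' → P In ts''
    forthIn (k , x) = σ S k , app (isoIn (βs S k)) x
    forthOut : P Out ts' → P Out ts''
    forthOut (k , x) = σ S k , app (isoOut (βs S k)) x

  -- the box tₘ moved to the front, in the shape of a composite  insertAt (tₘ ∷ X ∷ []) 1 rest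
  frontAt : (ts : List (Box {τ})) → Fin (length ts) → List (Box {τ})
  frontAt ts m = lookup ts m ∷ (removeAt ts m ++ [])

  reindex-frontAt : ∀ ts m → Σ[ R ∈ Reindexing ts (frontAt ts m) ] σ⁻ R zero ≡ m
  reindex-frontAt (t ∷ ts) zero    = reindex-∷ t (reindex-++[] ts) , refl
  reindex-frontAt (t ∷ ts) (suc m) =
    reindex-trans (reindex-∷ t (proj₁ (reindex-frontAt ts m))) (reindex-swap t (lookup ts m) (removeAt ts m ++ []))
    , cong suc (proj₂ (reindex-frontAt ts m))

  module Reindexed {ts ts' : List (Box {τ})} {v v' : Box {τ}}
                   (R : Reindexing ts ts') (β : BoxIso v v') (Φ : WD ts v) where

    forthSrc : Carrier (SrcPorts ts v) → Carrier (SrcPorts ts' v')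
    forthSrc = relabelSrc {ts} {ts'} (σ R) (βs R) β

    forthTgt : Carrier (TgtPorts ts v) → Carrier (TgtPorts ts' v')
    forthTgt = relabelTgt {ts} {ts'} (σ R) (βs R) β

    srcIso : TIso (SrcPorts ts v) (SrcPorts ts' v')
    srcIso = mkTIso (forthSrc) backSrc forth∘backSrc backSrc∘forth ty-forth
      where
      backSrc : Carrier (SrcPorts ts' v') → Carrier (SrcPorts ts v)
      backSrc (inj₁ x)       = inj₁ (app⁻ (isoIn β) x)
      backSrc (inj₂ (k , q)) = inj₂ (σ⁻ R k , app (isoOut (βs⁻ R k)) q)
      forth∘backSrc : ∀ x → forthSrc (backSrc x) ≡ x
      forth∘backSrc (inj₁ x)       = cong inj₁ (app∘app⁻ (isoIn β) x)
      forth∘backSrc (inj₂ (k , q)) = cong inj₂ (outPort-to∘from R k q)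
      backSrc∘forth : ∀ x → backSrc (forthSrc x) ≡ x
      backSrc∘forth (inj₁ x)       = cong inj₁ (app⁻∘app (isoIn β) x)
      backSrc∘forth (inj₂ (k , q)) = cong inj₂ (outPort-from∘to R k q)
      ty-forth : ∀ x → ty (SrcPorts ts' v') (forthSrc x) ≡ ty (SrcPorts ts v) x
      ty-forth (inj₁ x)       = pres (isoIn β) x
      ty-forth (inj₂ (k , q)) = pres (isoOut (βs R k)) q

    backTgt : Carrier (TgtPorts ts' v') → Carrier (TgtPorts ts v)
    backTgt (inj₁ (k , p)) = inj₁ (σ⁻ R k , app (isoIn (βs⁻ R k)) p)
    backTgt (inj₂ o)       = inj₂ (app⁻ (isoOut β) o)

    tgtIso : TIso (TgtPorts ts v) (TgtPorts ts' v')
    tgtIso = mkTIso (forthTgt) backTgt forth∘backTgt backTgt∘forth ty-forth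
      where
      forth∘backTgt : ∀ x → forthTgt (backTgt x) ≡ x
      forth∘backTgt (inj₁ (k , p)) = cong inj₁ (inPort-to∘from R k p)
      forth∘backTgt (inj₂ o)       = cong inj₂ (app∘app⁻ (isoOut β) o)
      ty-forth : ∀ x → ty (TgtPorts ts' v') (forthTgt x) ≡ ty (TgtPorts ts v) x
      ty-forth (inj₁ (k , p)) = pres (isoIn (βs R k)) p
      ty-forth (inj₂ o)       = pres (isoOut β) o
      backTgt∘forth : ∀ x → backTgt (forthTgt x) ≡ x
      backTgt∘forth (inj₁ (k , p)) = cong inj₁ (inPort-from∘to R k p)
      backTgt∘forth (inj₂ o)       = cong inj₂ (app⁻∘app (isoOut β) o)

    connection : TIso (SrcPorts ts' v') (TgtPorts ts' v')
    connection = tgtIso ∘ᵗ (connT Φ ∘ᵗ symᵗ srcIso)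

    prec-back : ∀ a q b p → forthTgt (conn Φ (inj₂ (σ⁻ R a , q))) ≡ inj₁ (b , p)
                → Prec ts v (src Φ) (tgt Φ) (σ⁻ R a) (σ⁻ R b)
    prec-back a q b p e = conn⇒Prec Φ (σ⁻ R a) q (σ⁻ R b) (proj₁ (entering (conn Φ (inj₂ (σ⁻ R a , q))) e))
                            (proj₂ (entering (conn Φ (inj₂ (σ⁻ R a , q))) e))
      where
      entering : ∀ z → forthTgt z ≡ inj₁ (b , p)
                 → Σ[ p₀ ∈ Elt (In (lookup ts (σ⁻ R b))) ] z ≡ inj₁ (σ⁻ R b , p₀)
      entering (inj₁ (k , p₀)) refl rewrite σ⁻∘σ R k = p₀ , refl

    diagram : WD ts' v'
    diagram = fromConn {ts'} {v'} connection
      (λ k cycle → progress Φ (σ⁻ R k) (tc-map (σ⁻ R) step cycle))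
      where
      step : ∀ {a b} → Prec ts' v' (srcPortSet≅SrcPorts ts' v') (connection ∘ᵗ srcPortSet≅SrcPorts ts' v') a b
             → Prec ts v (src Φ) (tgt Φ) (σ⁻ R a) (σ⁻ R b)
      step {a} {b} (.(inj₂ (a , q)) , (q , refl) , (p , e)) = prec-back a (app (isoOut (βs⁻ R a)) q) b p e

    β⁻ : BoxIso v' v
    β⁻ = record { isoIn = symᵗ (isoIn β) ; isoOut = symᵗ (isoOut β) }

    Φ≅diagram : Iso[ σ R , βs R , β ] Φ diagram
    Φ≅diagram = iso-byConn (σ R) (βs R) β Φ diagram srcIso (λ _ → refl) relabels
      where
      relabels : ConnRelabels (σ R) (βs R) β Φ diagram srcIso
      relabels x = cong (forthTgt ∘ conn Φ) (app⁻∘app srcIso x)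

    diagram≅Φ : Iso[ σ⁻ R , βs⁻ R , β⁻ ] diagram Φ
    diagram≅Φ = iso-byConn (σ⁻ R) (βs⁻ R) β⁻ diagram Φ (symᵗ srcIso)
                  (λ { (inj₁ _) → refl ; (inj₂ _) → refl }) relabels
      where
      relabels : ConnRelabels (σ⁻ R) (βs⁻ R) β⁻ diagram Φ (symᵗ srcIso)
      relabels x with conn Φ (app⁻ srcIso x)
      ... | inj₁ (k , p) = sym (cong inj₁ (inPort-from∘to R k p))
      ... | inj₂ o       = sym (cong inj₂ (app⁻∘app (isoOut β) o))

    generated⇒ : Generated Φ → Generated diagram
    generated⇒ g = gen-iso (mk↔ₛ′ (σ R) (σ⁻ R) (σ∘σ⁻ R) (σ⁻∘σ R)) (βs R) β g Φ≅diagram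

    ⇐generated : Generated diagram → Generated Φ
    ⇐generated g = gen-iso (mk↔ₛ′ (σ⁻ R) (σ R) (σ⁻∘σ R) (σ∘σ⁻ R)) (βs⁻ R) β⁻ g diagram≅Φ

  module Minimal {ts : List (Box {τ})} {v : Box {τ}} (Φ : WD ts v) where
    Precedes : Fin (length ts) → Fin (length ts) → Set
    Precedes = Prec ts v (src Φ) (tgt Φ)

    WireFromBoxInto : Elt (wires Φ) → Fin (length ts) → Set
    WireFromBoxInto w k = Σ[ j ∈ Fin (length ts) ]
        (Σ[ q ∈ Elt (Out (lookup ts j)) ] srcF Φ w ≡ inj₂ (j , q))
      × (Σ[ p ∈ Elt (In (lookup ts k)) ] tgtF Φ w ≡ inj₁ (k , p))

    wireFromBoxInto? : ∀ w k → Dec (WireFromBoxInto w k)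
    wireFromBoxInto? w k with srcF Φ w in e₁ | tgtF Φ w in e₂
    ... | inj₁ _       | _      = no λ { (_ , (_ , ()) , _) }
    ... | inj₂ (j , q) | inj₂ _ = no λ { (_ , _ , (_ , ())) }
    ... | inj₂ (j , q) | inj₁ (k' , p) with k' ≟ᶠ k
    ...   | yes refl = yes (j , (q , refl) , (p , refl))
    ...   | no k'≢k  = no λ { (_ , _ , (_ , e)) → k'≢k (cong proj₁ (inj₁-injective e)) }

    hasPredecessor? : ∀ k → Dec (Σ[ j ∈ Fin (length ts) ] Precedes j k)
    hasPredecessor? k with any? (λ f → wireFromBoxInto? (Inverse.from (enum (wires Φ)) f) k)
    ... | yes (f , (j , from-j , into-k)) = yes (j , Inverse.from (enum (wires Φ)) f , from-j , into-k)
    ... | no none = no λ { (j , w , from-j , into-k) → none (Inverse.to (enum (wires Φ)) w ,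
            subst (λ w' → WireFromBoxInto w' k) (sym (Inverse.strictlyInverseʳ (enum (wires Φ)) w))
                  (j , from-j , into-k)) }

    -- if every box had a predecessor, walking backwards would revisit a box
    module _ (pred : Fin (length ts) → Fin (length ts)) (pred-prec : ∀ k → Precedes (pred k) k)
             (k₀ : Fin (length ts)) where
      walk : ℕ → Fin (length ts)
      walk zero    = k₀
      walk (suc l) = pred (walk l)

      walk-path : ∀ l l' → l < l' → TransClosure Precedes (walk l') (walk l)
      walk-path l (suc l'') (s≤s l≤l'') with m≤n⇒m<n∨m≡n l≤l''
      ... | inj₁ l<l'' = pred-prec (walk l'') ∷ walk-path l l'' l<l''
      ... | inj₂ refl  = one (pred-prec (walk l))

      walk-cycle : ⊥
      walk-cycle with pigeonhole (n<1+n (length ts)) (λ (l : Fin (suc (length ts))) → walk (toℕ l))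
      ... | (l , l' , l<l' , same) = progress Φ (walk (toℕ l))
              (subst (λ z → TransClosure Precedes z (walk (toℕ l))) (sym same) (walk-path (toℕ l) (toℕ l') l<l'))

    minimal : Fin (length ts) → Σ[ m ∈ Fin (length ts) ] (∀ j → ¬ Precedes j m)
    minimal k₀ with all? hasPredecessor?
    ... | yes all-have = ⊥-elim (walk-cycle (proj₁ ∘ all-have) (proj₂ ∘ all-have) k₀)
    ... | no ¬all-have with ¬∀⟶∃¬ _ _ hasPredecessor? ¬all-have
    ...   | (m , no-pred) = m , λ j j≺m → no-pred (j , j≺m)

  boolToℕ : Bool → ℕ
  boolToℕ true  = 1
  boolToℕ false = 0

  count : ∀ n → (Fin n → Bool) → ℕ
  count zero    c = 0
  count (suc n) c = boolToℕ (c zero) + count n (c ∘ suc)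

  T↔Fin : ∀ b → T b ↔ Fin (boolToℕ b)
  T↔Fin true  = mk↔ₛ′ (λ _ → zero) (λ _ → tt) (λ { zero → refl }) (λ _ → refl)
  T↔Fin false = mk↔ₛ′ (λ ()) (λ ()) (λ ()) (λ ())

  Σ-T-≡ : ∀ {A : Set} {c : A → Bool} {x x' : A} {t : T (c x)} {t' : T (c x')}
          → x ≡ x' → _≡_ {A = Σ A (T ∘ c)} (x , t) (x' , t')
  Σ-T-≡ {t = t} {t'} refl = cong (_ ,_) (T-irrelevant t t')

  ΣFin↔count : ∀ n (c : Fin n → Bool) → Σ (Fin n) (T ∘ c) ↔ Fin (count n c)
  ΣFin↔count zero    c = mk↔ₛ′ (λ { (() , _) }) (λ ()) (λ ()) (λ { (() , _) })
  ΣFin↔count (suc n) c = ↔-trans split (↔-trans (T↔Fin (c zero) ⊎-↔ ΣFin↔count n (c ∘ suc)) (↔-sym +↔⊎))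
    where
    split : Σ (Fin (suc n)) (T ∘ c) ↔ (T (c zero) ⊎ Σ (Fin n) (T ∘ c ∘ suc))
    split = mk↔ₛ′ to from (λ { (inj₁ _) → refl ; (inj₂ _) → refl })
                          (λ { (zero , _) → refl ; (suc _ , _) → refl })
      where
      to : Σ (Fin (suc n)) (T ∘ c) → T (c zero) ⊎ Σ (Fin n) (T ∘ c ∘ suc)
      to (zero , t)  = inj₁ t
      to (suc k , t) = inj₂ (k , t)
      from : T (c zero) ⊎ Σ (Fin n) (T ∘ c ∘ suc) → Σ (Fin (suc n)) (T ∘ c)
      from (inj₁ t)       = zero , t
      from (inj₂ (k , t)) = suc k , t

  Σ-T-↔ : ∀ {A B : Set} (e : A ↔ B) (c : A → Bool) → Σ A (T ∘ c) ↔ Σ B (T ∘ c ∘ Inverse.from e)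
  Σ-T-↔ e c = mk↔ₛ′ to from
    (λ { (b , _) → Σ-T-≡ {c = c ∘ Inverse.from e} (Inverse.strictlyInverseˡ e b) })
    (λ { (a , _) → Σ-T-≡ {c = c} (Inverse.strictlyInverseʳ e a) })
    where
    to : Σ _ (T ∘ c) → Σ _ (T ∘ c ∘ Inverse.from e)
    to (a , t) = Inverse.to e a , subst (T ∘ c) (sym (Inverse.strictlyInverseʳ e a)) t
    from : Σ _ (T ∘ c ∘ Inverse.from e) → Σ _ (T ∘ c)
    from (b , t) = Inverse.from e b , t

  restrict : (X : TSet {τ}) → (Elt X → Bool) → TSet {τ}
  restrict X c = record
    { Elt  = Σ (Elt X) (T ∘ c)
    ; tyₛ  = tyₛ X ∘ proj₁
    ; size = count (size X) (c ∘ Inverse.from (enum X))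
    ; enum = ↔-trans (Σ-T-↔ (enum X) c) (ΣFin↔count (size X) (c ∘ Inverse.from (enum X))) }

  -- the box (P₀ , Q) in parallel with the identity on R, followed by the box (Q ⊕ R , O)
  module Whisker (P₀ Q R O : TSet {τ}) where
    connection₀ : TIso (SrcPorts (box P₀ Q ∷ []) (box (P₀ ⊕ₛ R) (Q ⊕ₛ R)))
                       (TgtPorts (box P₀ Q ∷ []) (box (P₀ ⊕ₛ R) (Q ⊕ₛ R)))
    connection₀ = mkTIso to from to∘from from∘to to-ty
      where
      to : Carrier (SrcPorts (box P₀ Q ∷ []) (box (P₀ ⊕ₛ R) (Q ⊕ₛ R)))
           → Carrier (TgtPorts (box P₀ Q ∷ []) (box (P₀ ⊕ₛ R) (Q ⊕ₛ R)))
      to (inj₁ (inj₁ p))   = inj₁ (zero , p)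
      to (inj₁ (inj₂ r))   = inj₂ (inj₂ r)
      to (inj₂ (zero , q)) = inj₂ (inj₁ q)
      from : Carrier (TgtPorts (box P₀ Q ∷ []) (box (P₀ ⊕ₛ R) (Q ⊕ₛ R)))
             → Carrier (SrcPorts (box P₀ Q ∷ []) (box (P₀ ⊕ₛ R) (Q ⊕ₛ R)))
      from (inj₁ (zero , p)) = inj₁ (inj₁ p)
      from (inj₂ (inj₁ q))   = inj₂ (zero , q)
      from (inj₂ (inj₂ r))   = inj₁ (inj₂ r)
      to∘from : ∀ y → to (from y) ≡ y
      to∘from (inj₁ (zero , p)) = refl
      to∘from (inj₂ (inj₁ q))   = refl
      to∘from (inj₂ (inj₂ r))   = refl
      from∘to : ∀ x → from (to x) ≡ x
      from∘to (inj₁ (inj₁ p))   = refl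
      from∘to (inj₁ (inj₂ r))   = refl
      from∘to (inj₂ (zero , q)) = refl
      to-ty : ∀ x → ty (TgtPorts (box P₀ Q ∷ []) (box (P₀ ⊕ₛ R) (Q ⊕ₛ R))) (to x)
                  ≡ ty (SrcPorts (box P₀ Q ∷ []) (box (P₀ ⊕ₛ R) (Q ⊕ₛ R))) x
      to-ty (inj₁ (inj₁ p))   = refl
      to-ty (inj₁ (inj₂ r))   = refl
      to-ty (inj₂ (zero , q)) = refl

    boxes : List (Box {τ})
    boxes = box P₀ Q ∷ box (Q ⊕ₛ R) O ∷ []

    connection : TIso (SrcPorts boxes (box (P₀ ⊕ₛ R) O)) (TgtPorts boxes (box (P₀ ⊕ₛ R) O))
    connection = mkTIso to from to∘from from∘to to-ty
      where
      to : Carrier (SrcPorts boxes (box (P₀ ⊕ₛ R) O)) → Carrier (TgtPorts boxes (box (P₀ ⊕ₛ R) O))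
      to (inj₁ (inj₁ p))       = inj₁ (zero , p)
      to (inj₁ (inj₂ r))       = inj₁ (suc zero , inj₂ r)
      to (inj₂ (zero , q))     = inj₁ (suc zero , inj₁ q)
      to (inj₂ (suc zero , o)) = inj₂ o
      from : Carrier (TgtPorts boxes (box (P₀ ⊕ₛ R) O)) → Carrier (SrcPorts boxes (box (P₀ ⊕ₛ R) O))
      from (inj₁ (zero , p))          = inj₁ (inj₁ p)
      from (inj₁ (suc zero , inj₁ q)) = inj₂ (zero , q)
      from (inj₁ (suc zero , inj₂ r)) = inj₁ (inj₂ r)
      from (inj₂ o)                   = inj₂ (suc zero , o)
      to∘from : ∀ y → to (from y) ≡ y
      to∘from (inj₁ (zero , p))          = refl
      to∘from (inj₁ (suc zero , inj₁ q)) = refl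
      to∘from (inj₁ (suc zero , inj₂ r)) = refl
      to∘from (inj₂ o)                   = refl
      from∘to : ∀ x → from (to x) ≡ x
      from∘to (inj₁ (inj₁ p))       = refl
      from∘to (inj₁ (inj₂ r))       = refl
      from∘to (inj₂ (zero , q))     = refl
      from∘to (inj₂ (suc zero , o)) = refl
      to-ty : ∀ x → ty (TgtPorts boxes (box (P₀ ⊕ₛ R) O)) (to x) ≡ ty (SrcPorts boxes (box (P₀ ⊕ₛ R) O)) x
      to-ty (inj₁ (inj₁ p))       = refl
      to-ty (inj₁ (inj₂ r))       = refl
      to-ty (inj₂ (zero , q))     = refl
      to-ty (inj₂ (suc zero , o)) = refl

    forward : Forward {boxes} {box (P₀ ⊕ₛ R) O} connection
    forward zero       .(suc zero) q .(inj₁ q) refl = s≤s z≤n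
    forward (suc zero) j q p ()

    diagram₀ : WD (box P₀ Q ∷ []) (box (P₀ ⊕ₛ R) (Q ⊕ₛ R))
    diagram₀ = fromForwardConn connection₀ (λ { zero j q p () })

    diagram : WD boxes (box (P₀ ⊕ₛ R) O)
    diagram = fromForwardConn connection forward

    agrees₀ : ConnAgrees (suc zero) (unitWD R) (paraWD P₀ R Q R) diagram₀
    agrees₀ (inj₁ (inj₁ p))   = refl
    agrees₀ (inj₁ (inj₂ r))   = refl
    agrees₀ (inj₂ (zero , q)) = refl

    agrees : ConnAgrees zero diagram₀ (seqWD (P₀ ⊕ₛ R) (Q ⊕ₛ R) O) diagram
    agrees (inj₁ (inj₁ p))       = refl
    agrees (inj₁ (inj₂ r))       = refl
    agrees (inj₂ (zero , q))     = refl
    agrees (inj₂ (suc zero , o)) = refl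

    diagram-generated : Generated diagram
    diagram-generated =
      gen-comp (gen-comp (gen-sym R idᵗ) (gen-para P₀ R Q R)
                 (isComposite-byConn (suc zero) (unitWD R) (paraWD P₀ R Q R) diagram₀ agrees₀))
               (gen-seq (P₀ ⊕ₛ R) (Q ⊕ₛ R) O)
               (isComposite-byConn zero diagram₀ (seqWD (P₀ ⊕ₛ R) (Q ⊕ₛ R) O) diagram agrees)

  index-injectˡ : ∀ (ss ts : List (Box {τ})) → Fin (length ss) → Fin (length (ss ++ ts))
  index-injectˡ (s ∷ ss) ts zero    = zero
  index-injectˡ (s ∷ ss) ts (suc k) = suc (index-injectˡ ss ts k)

  module _ (F : Box {τ} → TSet {τ}) where
    dropNil : ∀ (rs : List (Box {τ})) → P F (rs ++ []) → P F rs
    dropNil rs y = [ id , (λ { (() , _) }) ] (splitApp F rs [] y)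

    dropNil-injectˡ : ∀ rs y → dropNil rs (injectˡ F rs [] y) ≡ y
    dropNil-injectˡ rs y rewrite splitApp-injectˡ F rs [] y = refl

    injectˡ-dropNil : ∀ rs y → injectˡ F rs [] (dropNil rs y) ≡ y
    injectˡ-dropNil rs y with splitApp F rs [] y in e
    ... | inj₁ z = sym (injectˡ-splitApp F rs [] y z e)
    ... | inj₂ (() , _)

    tyᴾ-dropNil : ∀ rs y → tyᴾ F rs (dropNil rs y) ≡ tyᴾ F (rs ++ []) y
    tyᴾ-dropNil rs y = trans (sym (tyᴾ-injectˡ F rs [] (dropNil rs y))) (cong (tyᴾ F (rs ++ [])) (injectˡ-dropNil rs y))

    proj₁-injectˡ : ∀ (ss ts : List (Box {τ})) y → proj₁ (injectˡ F ss ts y) ≡ index-injectˡ ss ts (proj₁ y)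
    proj₁-injectˡ (s ∷ ss) ts (zero , x)  = refl
    proj₁-injectˡ (s ∷ ss) ts (suc k , x) = cong suc (proj₁-injectˡ ss ts (k , x))

  module PeelFirst (t : Box {τ}) (rs : List (Box {τ})) {v : Box {τ}} (Φ : WD (t ∷ (rs ++ [])) v)
                   (first-minimal : ∀ j q p → conn Φ (inj₂ (j , q)) ≡ inj₁ (zero , p) → ⊥) where
    boxes : List (Box {τ})
    boxes = t ∷ (rs ++ [])

    conn⁻ : Carrier (TgtPorts boxes v) → Carrier (SrcPorts boxes v)
    conn⁻ = app⁻ (connT Φ)

    intoFirst : Carrier (TgtPorts boxes v) → Bool
    intoFirst (inj₁ (zero , _))  = true
    intoFirst (inj₁ (suc _ , _)) = false
    intoFirst (inj₂ _)           = false

    NotIntoFirst : Carrier (TgtPorts boxes v) → Set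
    NotIntoFirst z = T (not (intoFirst z))

    notIntoFirst : ∀ z → (∀ p → z ≡ inj₁ (zero , p) → ⊥) → NotIntoFirst z
    notIntoFirst (inj₁ (zero , p))  not-first = ⊥-elim (not-first p refl)
    notIntoFirst (inj₁ (suc _ , _)) not-first = tt
    notIntoFirst (inj₂ _)           not-first = tt

    Rest : TSet {τ}
    Rest = restrict (In v) (λ a → not (intoFirst (conn Φ (inj₁ a))))

    -- since t is minimal, every input of t is wired to an outer input: In v ≅ In t ⊕ Rest
    splitInput-at : (a : Elt (In v)) (z : Carrier (TgtPorts boxes v)) → conn Φ (inj₁ a) ≡ z
                    → Elt (In t) ⊎ Elt Rest
    splitInput-at a (inj₁ (zero , p))  _ = inj₁ p
    splitInput-at a (inj₁ (suc k , p)) e = inj₂ (a , subst NotIntoFirst (sym e) tt)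
    splitInput-at a (inj₂ o)           e = inj₂ (a , subst NotIntoFirst (sym e) tt)

    splitInput : Elt (In v) → Elt (In t) ⊎ Elt Rest
    splitInput a = splitInput-at a (conn Φ (inj₁ a)) refl

    splitInput-first : ∀ a p → conn Φ (inj₁ a) ≡ inj₁ (zero , p) → splitInput a ≡ inj₁ p
    splitInput-first a p e = go (conn Φ (inj₁ a)) refl e
      where go : ∀ z (eq : conn Φ (inj₁ a) ≡ z) → z ≡ inj₁ (zero , p) → splitInput-at a z eq ≡ inj₁ p
            go .(inj₁ (zero , p)) eq refl = refl

    splitInput-rest : ∀ a (nf : NotIntoFirst (conn Φ (inj₁ a))) → splitInput a ≡ inj₂ (a , nf)
    splitInput-rest a nf = go (conn Φ (inj₁ a)) refl
      where go : ∀ z (eq : conn Φ (inj₁ a) ≡ z) → splitInput-at a z eq ≡ inj₂ (a , nf)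
            go (inj₁ (zero , p))  eq = ⊥-elim (subst NotIntoFirst eq nf)
            go (inj₁ (suc k , p)) eq = cong inj₂ (Σ-T-≡ {c = λ a → not (intoFirst (conn Φ (inj₁ a)))} refl)
            go (inj₂ o)           eq = cong inj₂ (Σ-T-≡ {c = λ a → not (intoFirst (conn Φ (inj₁ a)))} refl)

    outerSource : ∀ {p} (s : Carrier (SrcPorts boxes v)) → conn Φ s ≡ inj₁ (zero , p) → Elt (In v)
    outerSource (inj₁ a)       _ = a
    outerSource (inj₂ (j , q)) e = ⊥-elim (first-minimal j q _ e)

    outerSource-≡ : ∀ {p a} s (e : conn Φ s ≡ inj₁ (zero , p)) → s ≡ inj₁ a → outerSource s e ≡ a
    outerSource-≡ (inj₁ a) e refl = refl

    splitInput-outerSource : ∀ {p} s (e : conn Φ s ≡ inj₁ (zero , p)) → splitInput (outerSource s e) ≡ inj₁ p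
    splitInput-outerSource (inj₁ a)       e = splitInput-first a _ e
    splitInput-outerSource (inj₂ (j , q)) e = ⊥-elim (first-minimal j q _ e)

    joinInput : Elt (In t) ⊎ Elt Rest → Elt (In v)
    joinInput (inj₁ p)       = outerSource (conn⁻ (inj₁ (zero , p))) (app∘app⁻ (connT Φ) _)
    joinInput (inj₂ (a , _)) = a

    splitInput∘joinInput : ∀ u → splitInput (joinInput u) ≡ u
    splitInput∘joinInput (inj₁ p)        = splitInput-outerSource (conn⁻ (inj₁ (zero , p))) (app∘app⁻ (connT Φ) _)
    splitInput∘joinInput (inj₂ (a , nf)) = splitInput-rest a nf

    joinInput∘splitInput : ∀ a → joinInput (splitInput a) ≡ a
    joinInput∘splitInput a = go (conn Φ (inj₁ a)) refl
      where go : ∀ z (eq : conn Φ (inj₁ a) ≡ z) → joinInput (splitInput-at a z eq) ≡ a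
            go (inj₁ (zero , p))  eq = outerSource-≡ (conn⁻ (inj₁ (zero , p))) (app∘app⁻ (connT Φ) _)
                                         (trans (cong conn⁻ (sym eq)) (app⁻∘app (connT Φ) (inj₁ a)))
            go (inj₁ (suc k , p)) eq = refl
            go (inj₂ o)           eq = refl

    ty-splitInput : ∀ a → ty ⌊ In t ⊕ₛ Rest ⌋ (splitInput a) ≡ tyₛ (In v) a
    ty-splitInput a = go (conn Φ (inj₁ a)) refl
      where go : ∀ z (eq : conn Φ (inj₁ a) ≡ z) → ty ⌊ In t ⊕ₛ Rest ⌋ (splitInput-at a z eq) ≡ tyₛ (In v) a
            go (inj₁ (zero , p))  eq = trans (sym (cong (ty (TgtPorts boxes v)) eq)) (pres (connT Φ) (inj₁ a))
            go (inj₁ (suc k , p)) eq = refl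
            go (inj₂ o)           eq = refl

    inputSplit : TIso ⌊ In v ⌋ ⌊ In t ⊕ₛ Rest ⌋
    inputSplit = mkTIso splitInput joinInput splitInput∘joinInput joinInput∘splitInput ty-splitInput

    X : Box {τ}
    X = box (Out t ⊕ₛ Rest) (Out v)

    -- the rest of Φ, with the outputs of t and the inputs in Rest as the inputs of X
    toOuterSrc : Carrier (SrcPorts rs X) → Carrier (SrcPorts boxes v)
    toOuterSrc (inj₁ (inj₁ q))       = inj₂ (zero , q)
    toOuterSrc (inj₁ (inj₂ (a , _))) = inj₁ a
    toOuterSrc (inj₂ y)              = inj₂ (sucᴾ Out (injectˡ Out rs [] y))

    notIntoFirst-toOuterSrc : ∀ s → NotIntoFirst (conn Φ (toOuterSrc s))
    notIntoFirst-toOuterSrc (inj₁ (inj₁ q))        = notIntoFirst _ (first-minimal zero q)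
    notIntoFirst-toOuterSrc (inj₁ (inj₂ (a , nf))) = nf
    notIntoFirst-toOuterSrc (inj₂ y)               = notIntoFirst _ (first-minimal _ _)

    fromOuterSrc : (s : Carrier (SrcPorts boxes v)) → NotIntoFirst (conn Φ s) → Carrier (SrcPorts rs X)
    fromOuterSrc (inj₁ a)           nf = inj₁ (inj₂ (a , nf))
    fromOuterSrc (inj₂ (zero , q))  _  = inj₁ (inj₁ q)
    fromOuterSrc (inj₂ (suc k , q)) _  = inj₂ (dropNil Out rs (k , q))

    toRestTgt : (z : Carrier (TgtPorts boxes v)) → NotIntoFirst z → Carrier (TgtPorts rs X)
    toRestTgt (inj₁ (zero , p)) ()
    toRestTgt (inj₁ (suc k , p)) _ = inj₁ (dropNil In rs (k , p))
    toRestTgt (inj₂ o)           _ = inj₂ o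

    fromRestTgt : Carrier (TgtPorts rs X) → Carrier (TgtPorts boxes v)
    fromRestTgt (inj₁ y) = inj₁ (sucᴾ In (injectˡ In rs [] y))
    fromRestTgt (inj₂ o) = inj₂ o

    notIntoFirst-fromRestTgt : ∀ y → NotIntoFirst (fromRestTgt y)
    notIntoFirst-fromRestTgt (inj₁ _) = tt
    notIntoFirst-fromRestTgt (inj₂ _) = tt

    toRestTgt-cong : ∀ {z z'} (e : z ≡ z') (nf : NotIntoFirst z) (nf' : NotIntoFirst z')
                     → toRestTgt z nf ≡ toRestTgt z' nf'
    toRestTgt-cong refl nf nf' = cong (toRestTgt _) (T-irrelevant nf nf')

    fromOuterSrc-cong : ∀ {s s'} (e : s ≡ s') (nf : NotIntoFirst (conn Φ s)) (nf' : NotIntoFirst (conn Φ s'))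
                        → fromOuterSrc s nf ≡ fromOuterSrc s' nf'
    fromOuterSrc-cong refl nf nf' = cong (fromOuterSrc _) (T-irrelevant nf nf')

    toRestTgt∘fromRestTgt : ∀ y nf → toRestTgt (fromRestTgt y) nf ≡ y
    toRestTgt∘fromRestTgt (inj₁ y) nf = cong inj₁ (dropNil-injectˡ In rs y)
    toRestTgt∘fromRestTgt (inj₂ o) nf = refl

    fromRestTgt∘toRestTgt : ∀ z nf → fromRestTgt (toRestTgt z nf) ≡ z
    fromRestTgt∘toRestTgt (inj₁ (zero , p)) ()
    fromRestTgt∘toRestTgt (inj₁ (suc k , p)) nf = cong (inj₁ ∘ sucᴾ In) (injectˡ-dropNil In rs (k , p))
    fromRestTgt∘toRestTgt (inj₂ o)           nf = refl

    toOuterSrc∘fromOuterSrc : ∀ s nf → toOuterSrc (fromOuterSrc s nf) ≡ s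
    toOuterSrc∘fromOuterSrc (inj₁ a)           nf = refl
    toOuterSrc∘fromOuterSrc (inj₂ (zero , q))  nf = refl
    toOuterSrc∘fromOuterSrc (inj₂ (suc k , q)) nf = cong (inj₂ ∘ sucᴾ Out) (injectˡ-dropNil Out rs (k , q))

    fromOuterSrc∘toOuterSrc : ∀ s nf → fromOuterSrc (toOuterSrc s) nf ≡ s
    fromOuterSrc∘toOuterSrc (inj₁ (inj₁ q))        nf = refl
    fromOuterSrc∘toOuterSrc (inj₁ (inj₂ (a , _)))  nf =
      cong (inj₁ ∘ inj₂) (Σ-T-≡ {c = λ a → not (intoFirst (conn Φ (inj₁ a)))} refl)
    fromOuterSrc∘toOuterSrc (inj₂ y)               nf = cong inj₂ (dropNil-injectˡ Out rs y)

    restConn : Carrier (SrcPorts rs X) → Carrier (TgtPorts rs X)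
    restConn s = toRestTgt (conn Φ (toOuterSrc s)) (notIntoFirst-toOuterSrc s)

    restConn⁻ : Carrier (TgtPorts rs X) → Carrier (SrcPorts rs X)
    restConn⁻ y = fromOuterSrc (conn⁻ (fromRestTgt y))
                    (subst NotIntoFirst (sym (app∘app⁻ (connT Φ) (fromRestTgt y))) (notIntoFirst-fromRestTgt y))

    restConn∘restConn⁻ : ∀ y → restConn (restConn⁻ y) ≡ y
    restConn∘restConn⁻ y =
      trans (toRestTgt-cong (trans (cong (conn Φ) (toOuterSrc∘fromOuterSrc _ _)) (app∘app⁻ (connT Φ) (fromRestTgt y)))
                            _ (notIntoFirst-fromRestTgt y))
            (toRestTgt∘fromRestTgt y (notIntoFirst-fromRestTgt y))

    restConn⁻∘restConn : ∀ s → restConn⁻ (restConn s) ≡ s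
    restConn⁻∘restConn s =
      trans (fromOuterSrc-cong (trans (cong conn⁻ (fromRestTgt∘toRestTgt (conn Φ (toOuterSrc s)) _))
                                      (app⁻∘app (connT Φ) (toOuterSrc s)))
                               _ (notIntoFirst-toOuterSrc s))
            (fromOuterSrc∘toOuterSrc s (notIntoFirst-toOuterSrc s))

    ty-toRestTgt : ∀ z nf → ty (TgtPorts rs X) (toRestTgt z nf) ≡ ty (TgtPorts boxes v) z
    ty-toRestTgt (inj₁ (zero , p)) ()
    ty-toRestTgt (inj₁ (suc k , p)) nf = tyᴾ-dropNil In rs (k , p)
    ty-toRestTgt (inj₂ o)           nf = refl

    ty-toOuterSrc : ∀ s → ty (SrcPorts boxes v) (toOuterSrc s) ≡ ty (SrcPorts rs X) s
    ty-toOuterSrc (inj₁ (inj₁ q))       = refl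
    ty-toOuterSrc (inj₁ (inj₂ (a , _))) = refl
    ty-toOuterSrc (inj₂ y)              = tyᴾ-injectˡ Out rs [] y

    restConnection : TIso (SrcPorts rs X) (TgtPorts rs X)
    restConnection = mkTIso restConn restConn⁻ restConn∘restConn⁻ restConn⁻∘restConn
      (λ s → trans (ty-toRestTgt _ (notIntoFirst-toOuterSrc s)) (trans (pres (connT Φ) (toOuterSrc s)) (ty-toOuterSrc s)))

    -- box k of rs is box 1 + k of Φ, so a cycle of the rest would be a cycle of Φ
    rest : WD rs X
    rest = fromConn {rs} {X} restConnection
      (λ k cycle → progress Φ (index k) (tc-map index step cycle))
      where
      index : Fin (length rs) → Fin (length boxes)
      index k = suc (index-injectˡ rs [] k)
      step : ∀ {a b} → Prec rs X (srcPortSet≅SrcPorts rs X) (restConnection ∘ᵗ srcPortSet≅SrcPorts rs X) a b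
             → Prec boxes v (src Φ) (tgt Φ) (index a) (index b)
      step {a} {b} (.(inj₂ (a , q)) , (q , refl) , (p , e)) =
        subst₂ (Prec boxes v (src Φ) (tgt Φ)) (cong suc (proj₁-injectˡ Out rs [] (a , q)))
               (cong suc (proj₁-injectˡ In rs [] (b , p)))
          (conn⇒Prec Φ _ _ _ _ (trans (sym (fromRestTgt∘toRestTgt _ (notIntoFirst-toOuterSrc (inj₂ (a , q)))))
                                      (cong fromRestTgt e)))

    outerBox-iso : BoxIso (box (In t ⊕ₛ Rest) (Out v)) v
    outerBox-iso = record { isoIn = symᵗ inputSplit ; isoOut = idᵗ }

    module Outer = Reindexed (reindex-refl (t ∷ X ∷ [])) outerBox-iso (Whisker.diagram (In t) (Out t) Rest (Out v))

    outer : WD (t ∷ X ∷ []) v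
    outer = Outer.diagram

    open Fuse (suc zero) rest outer using (splitTgt; splitSrc)
    open Composition (suc zero) rest outer using (afterΨ; afterΦ; fusedConn)

    afterΨ-toRestTgt : ∀ z nf → afterΨ (toRestTgt z nf) ≡ splitTgt z
    afterΨ-toRestTgt (inj₁ (zero , p)) ()
    afterΨ-toRestTgt (inj₁ (suc k , p)) nf with splitApp In rs [] (k , p)
    ... | inj₁ y       = refl
    ... | inj₂ (() , _)
    afterΨ-toRestTgt (inj₂ o) nf = refl

    agrees-outerInput : ∀ a → splitTgt (conn Φ (inj₁ a)) ≡ fusedConn (splitSrc (inj₁ a))
    agrees-outerInput a = go (conn Φ (inj₁ a)) refl
      where
      outerConn : Elt (In t) ⊎ Elt Rest → Fuse.TgtFrame (suc zero) rest outer
      outerConn u = afterΦ (Outer.forthTgt (conn (Whisker.diagram (In t) (Out t) Rest (Out v)) (inj₁ u)))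
      go : ∀ z → conn Φ (inj₁ a) ≡ z → splitTgt (conn Φ (inj₁ a)) ≡ outerConn (splitInput a)
      go (inj₁ (zero , p)) eq = trans (cong splitTgt eq) (cong outerConn (sym (splitInput-first a p eq)))
      go (inj₁ (suc k , p)) eq = sym (trans (cong outerConn (splitInput-rest a (subst NotIntoFirst (sym eq) tt)))
                                            (afterΨ-toRestTgt (conn Φ (inj₁ a)) (subst NotIntoFirst (sym eq) tt)))
      go (inj₂ o) eq = sym (trans (cong outerConn (splitInput-rest a (subst NotIntoFirst (sym eq) tt)))
                                  (afterΨ-toRestTgt (conn Φ (inj₁ a)) (subst NotIntoFirst (sym eq) tt)))

    agrees-restOutput : ∀ y → splitTgt (conn Φ (toOuterSrc (inj₂ y))) ≡ fusedConn (splitSrc (toOuterSrc (inj₂ y)))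
    agrees-restOutput y =
      trans (sym (afterΨ-toRestTgt (conn Φ (toOuterSrc (inj₂ y))) (notIntoFirst-toOuterSrc (inj₂ y))))
            (cong (λ w → fusedConn (inj₂ w)) (sym (splitIns-injectInner Out (t ∷ X ∷ []) (suc zero) rs y)))

    agrees : ConnAgrees (suc zero) rest outer Φ
    agrees (inj₁ a)           = agrees-outerInput a
    agrees (inj₂ (zero , q))  =
      sym (afterΨ-toRestTgt (conn Φ (inj₂ (zero , q))) (notIntoFirst-toOuterSrc (inj₁ (inj₁ q))))
    agrees (inj₂ (suc k , q)) = subst (λ x → splitTgt (conn Φ x) ≡ fusedConn (splitSrc x))
                                      (cong (inj₂ ∘ sucᴾ Out) (injectˡ-dropNil Out rs (k , q)))
                                      (agrees-restOutput (dropNil Out rs (k , q)))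

    generated : Generated rest → Generated Φ
    generated g = gen-comp g (Outer.generated⇒ (Whisker.diagram-generated (In t) (Out t) Rest (Out v)))
                    (isComposite-byConn (suc zero) rest outer Φ agrees)

  -- without inner boxes, the connection map is a bijection In v ≅ Out v
  noInnerBoxes-generated : ∀ {v} (Φ : WD [] v) → Generated Φ
  noInnerBoxes-generated {v} Φ =
    gen-iso (mk↔ₛ′ (λ ()) (λ ()) (λ ()) (λ ())) (λ ()) boxIso (gen-sym (In v) idᵗ)
      (iso-byConn (λ ()) (λ ()) boxIso (symWD (In v) idᵗ) Φ
        (mkTIso id id (λ _ → refl) (λ _ → refl) (λ { (inj₁ _) → refl ; (inj₂ (() , _)) }))
        (λ { (inj₁ _) → refl ; (inj₂ (() , _)) })
        (λ { (inj₁ a) → sym (inj₂∘output (conn Φ (inj₁ a))) ; (inj₂ (() , _)) }))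
    where
    output : Carrier (TgtPorts [] v) → Elt (Out v)
    output (inj₁ (() , _))
    output (inj₂ o) = o
    input : Carrier (SrcPorts [] v) → Elt (In v)
    input (inj₁ a) = a
    input (inj₂ (() , _))
    inj₂∘output : ∀ z → inj₂ (output z) ≡ z
    inj₂∘output (inj₁ (() , _))
    inj₂∘output (inj₂ o) = refl
    inj₁∘input : ∀ s → inj₁ (input s) ≡ s
    inj₁∘input (inj₁ a) = refl
    inj₁∘input (inj₂ (() , _))
    through : TIso ⌊ In v ⌋ ⌊ Out v ⌋
    through = mkTIso (output ∘ conn Φ ∘ inj₁) (input ∘ app⁻ (connT Φ) ∘ inj₂)
      (λ o → cong output (trans (cong (conn Φ) (inj₁∘input _)) (app∘app⁻ (connT Φ) (inj₂ o))))
      (λ a → cong input (trans (cong (app⁻ (connT Φ)) (inj₂∘output _)) (app⁻∘app (connT Φ) (inj₁ a))))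
      (λ a → trans (cong (ty (TgtPorts [] v)) (inj₂∘output (conn Φ (inj₁ a)))) (pres (connT Φ) (inj₁ a)))
    boxIso : BoxIso (box (In v) (In v)) v
    boxIso = record { isoIn = idᵗ ; isoOut = through }

  minimal-generated : ∀ n (ts : List (Box {τ})) → length ts ≡ suc n
                      → (∀ (ts' : List (Box {τ})) → length ts' ≡ n → ∀ {v} (Φ : WD ts' v) → Generated Φ)
                      → ∀ {v} (Φ : WD ts v) (m : Fin (length ts)) → (∀ j → ¬ Prec ts v (src Φ) (tgt Φ) j m)
                      → Generated Φ
  minimal-generated n ts length≡ recurse {v} Φ m minimal =
    Front.⇐generated (Peeled.generated (recurse (removeAt ts m) length-rest Peeled.rest))
    where
    front = reindex-frontAt ts m
    module Front = Reindexed (proj₁ front) idBox Φ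
    first-minimal : ∀ j q p → conn Front.diagram (inj₂ (j , q)) ≡ inj₁ (zero , p) → ⊥
    first-minimal j q p e = minimal (σ⁻ (proj₁ front) j)
      (subst (Prec ts v (src Φ) (tgt Φ) (σ⁻ (proj₁ front) j)) (proj₂ front)
        (Front.prec-back j (app (isoOut (βs⁻ (proj₁ front) j)) q) zero p e))
    module Peeled = PeelFirst (lookup ts m) (removeAt ts m) Front.diagram first-minimal
    length-rest : length (removeAt ts m) ≡ n
    length-rest = suc-injective (trans (sym (length-removeAt′ ts m)) length≡)

  generated-byLength : ∀ n (ts : List (Box {τ})) → length ts ≡ n → ∀ {v} (Φ : WD ts v) → Generated Φ
  generated-byLength n       []       _  Φ = noInnerBoxes-generated Φ
  generated-byLength zero    (t ∷ ts) () Φ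
  generated-byLength (suc n) (t ∷ ts) eq Φ =
    minimal-generated n (t ∷ ts) eq (generated-byLength n) Φ (proj₁ minimal) (proj₂ minimal)
    where minimal = Minimal.minimal Φ zero

  generatedBySymSeqPara : GeneratedBySymSeqPara {τ}
  generatedBySymSeqPara {ts} = generated-byLength (length ts) ts refl

lemma5p1 : (τ : Set)
    → GeneratedBySymSeqPara {τ}
    × SeqUnital {τ} × SeqAssoc {τ}
    × ParaUnital {τ} × ParaAssoc {τ}
    × Interchange {τ}
    × PermSeq {τ} × PermPara {τ} × PermSwap {τ}
lemma5p1 τ = generatedBySymSeqPara , seqUnital , seqAssoc , paraUnital , paraAssoc
           , interchange , permSeq , permPara , permSwap
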